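{- Let $a,d,h$ be positive integers with $\gcd(a,d)=1$ and $ha-d>1$, let $A=(a,\ ha-d,\ ha+d)$, and let $s=\lfloor \frac{ha-d}{2h}\rfloor$. Then \begin{align*} g(A)&=\max\Big\{ \Big\lfloor \frac{ha-d}{2h}\Big\rfloor(ha+d)-a,\ \Big(a-\Big\lceil \frac{ha-d}{2h}\Big\rceil\Big)(ha-d)-a\Big\},\\ n(A)&=\frac{ha+d}{2a}s(s+1)+\frac{ha-d}{2a}(a-s)(a-s-1)-\frac{a-1}{2},\\ s(A)&=\Big(\frac{(ha+d)^2(2s+1)}{12a}-\frac{ha+d}{4}\Big)s(s+1)\\ &\quad+\Big(\frac{(ha-d)^2(2a-2s-1)}{12a}-\frac{ha-d}{4}\Big)(a-s)(a-s-1)+\frac{a^2-1}{12}, \end{align*} and for every positive integer $\mu$, \begin{align*} s_{\mu}(A)&=\frac{1}{\mu+1}\sum_{\kappa=0}^{\mu}\binom{\mu+1}{\kappa}\mathcal{B}_{\kappa}a^{\kappa-1}\Big((ha+d)^{\mu+1-\kappa}\sum_{r=0}^{s}r^{\mu+1-\kappa}+(ha-d)^{\mu+1-\kappa}\sum_{r=1}^{a-s-1}r^{\mu+1-\kappa}\Big)\\ &\quad+\frac{\mathcal{B}_{\mu+1}}{\mu+1}(a^{\mu+1}-1). \end{align*}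
   Context: For a vector $A=(a_1,\dots,a_n)$ of positive integers with $\gcd(A)=1$, an integer $a_0\geq 0$ is representable by $A$ if $a_0=\sum_i a_ix_i$ for some $x_i\in\mathbb{N}=\{0,1,2,\dots\}$. Let $\mathcal{NR}(A)$ be the (finite) set of nonnegative integers not representable by $A$. Define $g(A)=\max\mathcal{NR}(A)$, $n(A)=\#\mathcal{NR}(A)$, $s(A)=\sum_{m\in\mathcal{NR}(A)}m$, and the Sylvester power sum $s_\mu(A)=\sum_{m\in\mathcal{NR}(A)}m^\mu$. $\mathcal{B}_\kappa$ denotes the Bernoulli numbers, with $\mathcal{B}_0=1$, $\mathcal{B}_1=-\tfrac12$, $\mathcal{B}_2=\tfrac16,\dots$ (i.e. $\frac{t}{e^t-1}=\sum_{n\ge0}\mathcal{B}_n t^n/n!$). -}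

module Defs where

open import Data.Nat as ℕ using (ℕ; zero; suc; _≤_; _<_; z≤n; s≤s)
open import Data.Nat.Properties as ℕP
open import Data.Nat.Combinatorics using (_C_)
open import Data.Integer as ℤ using (ℤ; +_)
open import Data.Rational as ℚ using (ℚ; _/_)
open import Data.Fin using (Fin; toℕ; fromℕ<)
open import Data.Fin.Properties using (any?; toℕ<n; toℕ-fromℕ<)
open import Data.List using (List; []; _∷_; _++_; [_]; filter; upTo; zipWith; map; foldr)
open import Data.Product using (Σ; ∃; _×_; _,_; proj₁; proj₂)
open import Relation.Nullary using (Dec; yes; no; ¬_; ¬?)
open import Relation.Nullary.Decidable using (map′)
open import Relation.Binary.PropositionalEquality using (_≡_; refl; sym; trans; cong; cong₂; subst)

Representable : ℕ → ℕ → ℕ → ℕ → Set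
Representable a₁ a₂ a₃ m =
  ∃ λ x₁ → ∃ λ x₂ → ∃ λ x₃ → a₁ ℕ.* x₁ ℕ.+ a₂ ℕ.* x₂ ℕ.+ a₃ ℕ.* x₃ ≡ m

private
  BRep : ℕ → ℕ → ℕ → ℕ → Set
  BRep a b c m = ∃ λ (x : Fin (suc m)) → ∃ λ (y : Fin (suc m)) → ∃ λ (z : Fin (suc m)) →
    a ℕ.* toℕ x ℕ.+ b ℕ.* toℕ y ℕ.+ c ℕ.* toℕ z ≡ m

  norm : (a x m : ℕ) → a ℕ.* x ≤ m → Σ (Fin (suc m)) λ x' → a ℕ.* toℕ x' ≡ a ℕ.* x
  norm zero x m _ = Fin.zero , refl
    where import Data.Fin as Fin
  norm (suc a) x m le =
    fromℕ< (s≤s (≤-trans (m≤m+n x (a ℕ.* x)) le)) ,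
    cong (suc a ℕ.*_) (toℕ-fromℕ< (s≤s (≤-trans (m≤m+n x (a ℕ.* x)) le)))

  to : ∀ a b c m → Representable a b c m → BRep a b c m
  to a b c m (x , y , z , eq) =
    let lx = ≤-trans (≤-trans (m≤m+n (a ℕ.* x) (b ℕ.* y)) (m≤m+n _ (c ℕ.* z))) (≤-reflexive eq)
        ly = ≤-trans (≤-trans (m≤n+m (b ℕ.* y) (a ℕ.* x)) (m≤m+n _ (c ℕ.* z))) (≤-reflexive eq)
        lz = ≤-trans (m≤n+m (c ℕ.* z) (a ℕ.* x ℕ.+ b ℕ.* y)) (≤-reflexive eq)
        (x' , ex) = norm a x m lx
        (y' , ey) = norm b y m ly
        (z' , ez) = norm c z m lz
    in x' , y' , z' , trans (cong₂ ℕ._+_ (cong₂ ℕ._+_ ex ey) ez) eq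

  from : ∀ a b c m → BRep a b c m → Representable a b c m
  from a b c m (x , y , z , eq) = toℕ x , toℕ y , toℕ z , eq

representable? : ∀ a₁ a₂ a₃ m → Dec (Representable a₁ a₂ a₃ m)
representable? a b c m =
  map′ (from a b c m) (to a b c m)
    (any? λ x → any? λ y → any? λ z →
      (a ℕ.* toℕ x ℕ.+ b ℕ.* toℕ y ℕ.+ c ℕ.* toℕ z) ℕP.≟ m)

-- the non-representable numbers below N, in increasing order.
-- If every m ≥ N is representable, this list is exactly NR(A).
NRbelow : ℕ → ℕ → ℕ → ℕ → List ℕ
NRbelow a₁ a₂ a₃ N = filter (λ m → ¬? (representable? a₁ a₂ a₃ m)) (upTo N)

sumℕ : List ℕ → ℕ
sumℕ = foldr ℕ._+_ 0

sumℚ : List ℚ → ℚ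
sumℚ = foldr ℚ._+_ ℚ.0ℚ

toℚ : ℕ → ℚ
toℚ n = + n / 1

-- x / d for a natural denominator d (total; only used with d > 0)
_÷ℕ_ : ℚ → ℕ → ℚ
x ÷ℕ zero = ℚ.0ℚ
x ÷ℕ suc d = x ℚ.* (+ 1 / suc d)

-- Bernoulli numbers, B₀ = 1, B₁ = -1/2, via
--   B_n = - 1/(n+1) Σ_{k<n} C(n+1,k) B_k   (n ≥ 1),
-- equivalently t/(e^t-1) = Σ B_n t^n / n!.

-- newB n [B₀,…,B_{n-1}] = B_n
newB : ℕ → List ℚ → ℚ
newB zero    _    = ℚ.1ℚ
newB (suc m) prev =
  ℚ.- ((sumℚ (zipWith (λ k b → toℚ ((suc (suc m)) C k) ℚ.* b) (upTo (suc m)) prev)) ÷ℕ suc (suc m))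

Bs : ℕ → List ℚ
Bs zero    = []
Bs (suc n) = Bs n ++ [ newB n (Bs n) ]

bernoulli : ℕ → ℚ
bernoulli n = newB n (Bs n)

-- Floor and ceiling of n / k for naturals (k > 0; total, 0 when k = 0)

floorDiv : ℕ → ℕ → ℕ
floorDiv n zero    = 0
floorDiv n (suc k) = n ℕ./ suc k

ceilDiv : ℕ → ℕ → ℕ
ceilDiv n k = floorDiv (n ℕ.+ k ℕ.∸ 1) k

{-# OPTIONS --safe #-}

-- Since b + c = 2ha ≡ 0 (mod a), a representation m = ax + by + cz can be
-- rewritten as m = e·c + k·a or m = e·b + k·a with k ≥ 0. Hence, for t < a, the
-- least element of ⟨a, b, c⟩ congruent to t·d modulo a is t·c when t ≤ s and
-- (a − t)·b otherwise, s being where these two values cross; as gcd(a, d) = 1,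
-- the classes of t·d exhaust the residues. The Frobenius number is the largest
-- of these Apéry elements minus a, attained at t = s or t = s + 1.
-- The gaps in the class of an Apéry element w ≡ ρ are w − a, w − 2a, …, ρ, so by
-- the shift law P(x + a) − P(x) = (μ + 1)·a·x^μ of the homogenised Bernoulli
-- polynomial P = a^(μ+1)·B_(μ+1)(· / a) the sum of their μ-th powers is
-- (P(w) − P(ρ)) / ((μ + 1)·a). Raabe's identity Σ_{ρ<a} P(ρ) = a·B_(μ+1)
-- disposes of the residues, leaving s_μ(A) in terms of the power sums of the
-- Apéry set; n(A) and s(A) are the cases μ = 0, 1 together with the closed forms
-- of Σ r and Σ r².

module Submission where

open import Defs
open import Data.Nat as ℕ using (ℕ; suc; _≤_; _<_; _∸_; _^_)
open import Data.Nat.GCD using (gcd)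
open import Data.Nat.Combinatorics using (_C_)
open import Data.Integer as ℤ using (ℤ; +_)
open import Data.Rational as ℚ using (ℚ; 1ℚ)
open import Data.List using (List; length; map; upTo)
open import Data.Product using (_×_)
open import Relation.Nullary using (¬_)
open import Relation.Binary.PropositionalEquality using (_≡_)

module Cast where

  open import Data.Nat as ℕ using (ℕ; zero; suc; NonZero)
  import Data.Nat.Properties as ℕ
  open import Data.Nat.Coprimality as Coprime using (1-coprimeTo)
  open import Data.Integer as ℤ using (+_)
  import Data.Integer.Properties as ℤ
  open import Data.Maybe using (Maybe; just; nothing)
  open import Data.List using (List; []; _∷_; map)
  open import Data.Rational using (ℚ; 0ℚ; 1ℚ; _+_; _*_; mkℚ; _/_)
  open import Data.Rational.Properties
  open import Level using (0ℓ)
  open import Relation.Nullary using (yes; no)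
  open import Function using (_∘_)
  open import Relation.Binary.PropositionalEquality
    using (_≡_; refl; sym; trans; cong; cong₂; subst; module ≡-Reasoning)
  import Tactic.RingSolver as Ring
  import Tactic.RingSolver.Core.AlmostCommutativeRing as ACR
  open import Algebra.Bundles using (CommutativeRing)
  open import Algebra.Properties.CommutativeSemiring.Exp
    (CommutativeRing.commutativeSemiring +-*-commutativeRing) public
    using (^-homo-*; ^-distrib-*) renaming (_^_ to _^ℚ_)

  ℚ-ring : ACR.AlmostCommutativeRing 0ℓ 0ℓ
  ℚ-ring = ACR.fromCommutativeRing +-*-commutativeRing isZero
    where
    isZero : (x : ℚ) → Maybe (0ℚ ≡ x)
    isZero x with x ≟ 0ℚ
    ... | yes x≡0 = just (sym x≡0)
    ... | no _    = nothing

  private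
    toℚ≡mkℚ : ∀ n → toℚ n ≡ mkℚ (+ n) 0 (Coprime.sym (1-coprimeTo n))
    toℚ≡mkℚ n = normalize-coprime (Coprime.sym (1-coprimeTo n))

    1/suc≡mkℚ : ∀ d → + 1 / suc d ≡ mkℚ (+ 1) d (1-coprimeTo (suc d))
    1/suc≡mkℚ d = normalize-coprime (1-coprimeTo (suc d))

  -- ι is toℚ made opaque: unfolding the normalising division inside toℚ during
  -- conversion checking is very slow. Closed numerals are still written toℚ k,
  -- which compute, so that the ring solver reads them as constants.
  opaque
    ι : ℕ → ℚ
    ι = toℚ

    ι≡toℚ : ι ≡ toℚ
    ι≡toℚ = refl

    ι-+ : ∀ m n → ι (m ℕ.+ n) ≡ ι m + ι n
    ι-+ m n rewrite toℚ≡mkℚ m | toℚ≡mkℚ n | toℚ≡mkℚ (m ℕ.+ n) =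
      trans (sym (toℚ≡mkℚ (m ℕ.+ n)))
        (cong (λ k → k / 1) (sym (cong₂ ℤ._+_ (ℤ.*-identityʳ (+ m)) (ℤ.*-identityʳ (+ n)))))

    ι-* : ∀ m n → ι (m ℕ.* n) ≡ ι m * ι n
    ι-* m n rewrite toℚ≡mkℚ m | toℚ≡mkℚ n = cong (λ k → k / 1) (ℤ.pos-* m n)

    ι-0 : ι 0 ≡ 0ℚ
    ι-0 = refl

    ι-1 : ι 1 ≡ 1ℚ
    ι-1 = refl

    ÷ℕ-*-cancel : ∀ x n .{{_ : NonZero n}} → (x ÷ℕ n) * ι n ≡ x
    ÷ℕ-*-cancel x (suc d) = begin
      x * (+ 1 / suc d) * toℚ (suc d)    ≡⟨ *-assoc x _ _ ⟩
      x * ((+ 1 / suc d) * toℚ (suc d))  ≡⟨ cong (x *_) inverse ⟩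
      x * 1ℚ                             ≡⟨ *-identityʳ x ⟩
      x                                  ∎
      where
      open ≡-Reasoning
      inverse : (+ 1 / suc d) * toℚ (suc d) ≡ 1ℚ
      inverse rewrite 1/suc≡mkℚ d | toℚ≡mkℚ (suc d) = *-inverseˡ (mkℚ (+ suc d) 0 (Coprime.sym (1-coprimeTo (suc d))))

  ι-suc : ∀ n → ι (suc n) ≡ ι n + 1ℚ
  ι-suc n = trans (ι-+ 1 n) (trans (cong (_+ ι n) ι-1) (+-comm 1ℚ (ι n)))

  ι-^ : ∀ m k → ι (m ℕ.^ k) ≡ ι m ^ℚ k
  ι-^ m zero    = ι-1
  ι-^ m (suc k) = trans (ι-* m (m ℕ.^ k)) (cong (ι m *_) (ι-^ m k))

  ι-*-^ : ∀ m n p → ι (m ℕ.* n) ^ℚ p ≡ ι m ^ℚ p * ι n ^ℚ p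
  ι-*-^ m n p = trans (cong (_^ℚ p) (ι-* m n)) (^-distrib-* (ι m) (ι n) p)

  1^ℚ : ∀ n → 1ℚ ^ℚ n ≡ 1ℚ
  1^ℚ zero    = refl
  1^ℚ (suc n) = trans (*-identityˡ (1ℚ ^ℚ n)) (1^ℚ n)

  ι-sumℕ : ∀ (xs : List ℕ) → ι (sumℕ xs) ≡ sumℚ (map ι xs)
  ι-sumℕ []       = ι-0
  ι-sumℕ (x ∷ xs) = trans (ι-+ x (sumℕ xs)) (cong (λ s → ι x + s) (ι-sumℕ xs))

  ι-*-cancelˡ : ∀ n .{{_ : NonZero n}} {x y} → ι n * x ≡ ι n * y → x ≡ y
  ι-*-cancelˡ n@(suc _) {x} {y} nx≡ny = begin
    x               ≡⟨ ÷ℕ-*-cancel x n ⟨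
    x ÷ℕ n * ι n    ≡⟨ commute x (+ 1 / n) (ι n) ⟩
    (ι n * x) ÷ℕ n  ≡⟨ cong (_÷ℕ n) nx≡ny ⟩
    (ι n * y) ÷ℕ n  ≡⟨ commute y (+ 1 / n) (ι n) ⟨
    y ÷ℕ n * ι n    ≡⟨ ÷ℕ-*-cancel y n ⟩
    y               ∎
    where
    open ≡-Reasoning
    commute : ∀ z r m → z * r * m ≡ m * z * r
    commute = Ring.solve-∀ ℚ-ring

  toℚ-*-cancelˡ : ∀ n .{{_ : NonZero n}} {x y} → toℚ n * x ≡ toℚ n * y → x ≡ y
  toℚ-*-cancelˡ n {x} {y} = ι-*-cancelˡ n ∘ subst (λ f → f n * x ≡ f n * y) (sym ι≡toℚ)

module FiniteSums where

  open Cast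
  open import Data.Nat as ℕ using (ℕ; zero; suc; _≤_; _<_; _∸_)
  import Data.Nat.Properties as ℕ
  open import Data.Fin using (toℕ)
  open import Data.List using (List; []; _∷_; map; upTo; applyUpTo; filter)
  open import Data.Rational using (ℚ; 0ℚ; 1ℚ; _+_; _*_; _-_; -_)
  open import Data.Rational.Properties
  open import Data.Sum using (inj₁; inj₂)
  open import Data.Empty using (⊥-elim)
  open import Function using (_∘_)
  open import Relation.Nullary using (Dec; yes; no; ¬_)
  open import Relation.Unary using (Decidable)
  open import Relation.Binary.PropositionalEquality
    using (_≡_; _≢_; refl; sym; trans; cong; cong₂; module ≡-Reasoning)
  open import Algebra.Bundles using (CommutativeRing)
  open import Algebra.Definitions.RawMonoid (CommutativeRing.+-rawMonoid +-*-commutativeRing)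
    using (sum)
  import Tactic.RingSolver as Ring

  open ≡-Reasoning

  ∑< : ℕ → (ℕ → ℚ) → ℚ
  ∑< zero    f = 0ℚ
  ∑< (suc n) f = ∑< n f + f n

  syntax ∑< n (λ i → e) = ∑[ i < n ] e

  ∑-cong : ∀ n {f g : ℕ → ℚ} → (∀ i → i < n → f i ≡ g i) → ∑< n f ≡ ∑< n g
  ∑-cong zero    f≗g = refl
  ∑-cong (suc n) f≗g = cong₂ _+_ (∑-cong n (λ i i<n → f≗g i (ℕ.m<n⇒m<1+n i<n))) (f≗g n ℕ.≤-refl)

  ∑-zero : ∀ n → ∑[ i < n ] 0ℚ ≡ 0ℚ
  ∑-zero zero    = refl
  ∑-zero (suc n) = trans (+-identityʳ _) (∑-zero n)

  ∑-distrib-+ : ∀ n f g → ∑[ i < n ] (f i + g i) ≡ ∑< n f + ∑< n g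
  ∑-distrib-+ zero    f g = refl
  ∑-distrib-+ (suc n) f g =
    trans (cong (_+ (f n + g n)) (∑-distrib-+ n f g)) (interchange (∑< n f) (∑< n g) (f n) (g n))
    where
    interchange : ∀ a b c d → (a + b) + (c + d) ≡ (a + c) + (b + d)
    interchange = Ring.solve-∀ ℚ-ring

  *-distribˡ-∑ : ∀ n c f → c * ∑< n f ≡ ∑[ i < n ] (c * f i)
  *-distribˡ-∑ zero    c f = *-zeroʳ c
  *-distribˡ-∑ (suc n) c f = trans (*-distribˡ-+ c (∑< n f) (f n)) (cong (_+ c * f n) (*-distribˡ-∑ n c f))

  *-distribʳ-∑ : ∀ n c f → ∑< n f * c ≡ ∑[ i < n ] (f i * c)
  *-distribʳ-∑ n c f = trans (*-comm _ c) (trans (*-distribˡ-∑ n c f) (∑-cong n (λ i _ → *-comm c (f i))))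

  neg-distrib-∑ : ∀ n f → - ∑< n f ≡ ∑[ i < n ] (- f i)
  neg-distrib-∑ zero    f = refl
  neg-distrib-∑ (suc n) f = trans (neg-distrib-+ (∑< n f) (f n)) (cong (_+ - f n) (neg-distrib-∑ n f))

  ∑-const : ∀ n x → ∑[ i < n ] x ≡ ι n * x
  ∑-const zero    x = trans (sym (*-zeroˡ x)) (cong (_* x) (sym ι-0))
  ∑-const (suc n) x = begin
    ∑[ i < n ] x + x  ≡⟨ cong (_+ x) (∑-const n x) ⟩
    ι n * x + x       ≡⟨ cong (_+_ (ι n * x)) (sym (*-identityˡ x)) ⟩
    ι n * x + 1ℚ * x  ≡⟨ *-distribʳ-+ x (ι n) 1ℚ ⟨
    (ι n + 1ℚ) * x    ≡⟨ cong (_* x) (ι-suc n) ⟨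
    ι (suc n) * x     ∎

  ∑-head : ∀ n f → ∑< (suc n) f ≡ f 0 + ∑[ i < n ] f (suc i)
  ∑-head zero    f = trans (+-identityˡ (f 0)) (sym (+-identityʳ (f 0)))
  ∑-head (suc n) f = trans (cong (_+ f (suc n)) (∑-head n f)) (+-assoc (f 0) _ (f (suc n)))

  ∑-split : ∀ m n f → ∑< (m ℕ.+ n) f ≡ ∑< m f + ∑[ i < n ] f (m ℕ.+ i)
  ∑-split m zero    f = trans (cong (λ k → ∑< k f) (ℕ.+-identityʳ m)) (sym (+-identityʳ (∑< m f)))
  ∑-split m (suc n) f = begin
    ∑< (m ℕ.+ suc n) f                               ≡⟨ cong (λ k → ∑< k f) (ℕ.+-suc m n) ⟩
    ∑< (m ℕ.+ n) f + f (m ℕ.+ n)                     ≡⟨ cong (_+ f (m ℕ.+ n)) (∑-split m n f) ⟩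
    (∑< m f + ∑[ i < n ] f (m ℕ.+ i)) + f (m ℕ.+ n)  ≡⟨ +-assoc (∑< m f) _ _ ⟩
    ∑< m f + ∑[ i < suc n ] f (m ℕ.+ i)              ∎

  ∑-zero-tail : ∀ n k f → (∀ i → n ≤ i → f i ≡ 0ℚ) → ∑< (n ℕ.+ k) f ≡ ∑< n f
  ∑-zero-tail n k f tail≡0 = begin
    ∑< (n ℕ.+ k) f                   ≡⟨ ∑-split n k f ⟩
    ∑< n f + ∑[ i < k ] f (n ℕ.+ i)  ≡⟨ cong (_+_ (∑< n f)) (∑-cong k (λ i _ → tail≡0 (n ℕ.+ i) (ℕ.m≤m+n n i))) ⟩
    ∑< n f + ∑[ i < k ] 0ℚ           ≡⟨ cong (_+_ (∑< n f)) (∑-zero k) ⟩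
    ∑< n f + 0ℚ                      ≡⟨ +-identityʳ _ ⟩
    ∑< n f                           ∎

  ∑-last : ∀ n f → (∀ i → i < n → f i ≡ 0ℚ) → ∑< (suc n) f ≡ f n
  ∑-last n f init≡0 = trans (cong (_+ f n) (trans (∑-cong n init≡0) (∑-zero n))) (+-identityˡ (f n))

  ∑-comm : ∀ m n (f : ℕ → ℕ → ℚ) → ∑[ i < m ] ∑[ j < n ] f i j ≡ ∑[ j < n ] ∑[ i < m ] f i j
  ∑-comm zero    n f = sym (∑-zero n)
  ∑-comm (suc m) n f = begin
    ∑[ i < m ] ∑[ j < n ] f i j + ∑[ j < n ] f m j  ≡⟨ cong (_+ ∑[ j < n ] f m j) (∑-comm m n f) ⟩
    ∑[ j < n ] ∑[ i < m ] f i j + ∑[ j < n ] f m j  ≡⟨ ∑-distrib-+ n _ _ ⟨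
    ∑[ j < n ] ∑[ i < suc m ] f i j                 ∎

  ∑-telescope : ∀ n (F : ℕ → ℚ) → ∑[ i < n ] (F (suc i) - F i) ≡ F n - F 0
  ∑-telescope zero    F = sym (+-inverseʳ (F 0))
  ∑-telescope (suc n) F =
    trans (cong (_+ (F (suc n) - F n)) (∑-telescope n F)) (collapse (F n) (F 0) (F (suc n)))
    where
    collapse : ∀ x y z → (x - y) + (z - x) ≡ z - y
    collapse = Ring.solve-∀ ℚ-ring

  ∑-reverse : ∀ n f → ∑< n f ≡ ∑[ i < n ] f (n ∸ suc i)
  ∑-reverse zero    f = refl
  ∑-reverse (suc n) f = begin
    ∑< n f + f n                      ≡⟨ cong (_+ f n) (∑-reverse n f) ⟩
    ∑[ i < n ] f (n ∸ suc i) + f n    ≡⟨ +-comm _ (f n) ⟩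
    f n + ∑[ i < n ] f (n ∸ suc i)    ≡⟨ ∑-head n (λ i → f (suc n ∸ suc i)) ⟨
    ∑[ i < suc n ] f (suc n ∸ suc i)  ∎

  ∑-blocks : ∀ K a (G : ℕ → ℚ) → ∑< (K ℕ.* a) G ≡ ∑[ k < K ] ∑[ ρ < a ] G (ρ ℕ.+ k ℕ.* a)
  ∑-blocks zero    a G = refl
  ∑-blocks (suc K) a G = begin
    ∑< (a ℕ.+ K ℕ.* a) G
      ≡⟨ ∑-split a (K ℕ.* a) G ⟩
    ∑< a G + ∑[ i < K ℕ.* a ] G (a ℕ.+ i)
      ≡⟨ cong₂ _+_ (∑-cong a (λ ρ _ → cong G (sym (ℕ.+-identityʳ ρ)))) (∑-blocks K a (λ i → G (a ℕ.+ i))) ⟩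
    ∑[ ρ < a ] G (ρ ℕ.+ 0) + ∑[ k < K ] ∑[ ρ < a ] G (a ℕ.+ (ρ ℕ.+ k ℕ.* a))
      ≡⟨ cong (_+_ (∑[ ρ < a ] G (ρ ℕ.+ 0))) (∑-cong K (λ k _ → ∑-cong a (λ ρ _ → cong G (next-block ρ k)))) ⟩
    ∑[ ρ < a ] G (ρ ℕ.+ 0 ℕ.* a) + ∑[ k < K ] ∑[ ρ < a ] G (ρ ℕ.+ suc k ℕ.* a)
      ≡⟨ ∑-head K (λ k → ∑[ ρ < a ] G (ρ ℕ.+ k ℕ.* a)) ⟨
    ∑[ k < suc K ] ∑[ ρ < a ] G (ρ ℕ.+ k ℕ.* a)  ∎
    where
    next-block : ∀ ρ k → a ℕ.+ (ρ ℕ.+ k ℕ.* a) ≡ ρ ℕ.+ suc k ℕ.* a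
    next-block ρ k = trans (sym (ℕ.+-assoc a ρ _)) (trans (cong (ℕ._+ k ℕ.* a) (ℕ.+-comm a ρ)) (ℕ.+-assoc ρ a _))

  ∑-diagonals : ∀ n (f : ℕ → ℕ → ℚ) →
    ∑[ i < n ] ∑[ j < n ∸ i ] f i j ≡ ∑[ t < n ] ∑[ i < suc t ] f i (t ∸ i)
  ∑-diagonals zero    f = refl
  ∑-diagonals (suc n) f = begin
    ∑[ i < suc n ] ∑[ j < suc n ∸ i ] f i j
      ≡⟨ ∑-cong (suc n) (λ i i≤n → cong (λ k → ∑< k (f i)) (ℕ.+-∸-assoc 1 (ℕ.≤-pred i≤n))) ⟩
    ∑[ i < suc n ] (∑[ j < n ∸ i ] f i j + f i (n ∸ i))
      ≡⟨ ∑-distrib-+ (suc n) _ _ ⟩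
    (∑[ i < n ] ∑[ j < n ∸ i ] f i j + ∑[ j < n ∸ n ] f n j) + ∑[ i < suc n ] f i (n ∸ i)
      ≡⟨ cong (λ k → (∑[ i < n ] ∑[ j < n ∸ i ] f i j + ∑< k (f n)) + ∑[ i < suc n ] f i (n ∸ i)) (ℕ.n∸n≡0 n) ⟩
    (∑[ i < n ] ∑[ j < n ∸ i ] f i j + 0ℚ) + ∑[ i < suc n ] f i (n ∸ i)
      ≡⟨ cong (_+ ∑[ i < suc n ] f i (n ∸ i)) (trans (+-identityʳ _) (∑-diagonals n f)) ⟩
    ∑[ t < n ] ∑[ i < suc t ] f i (t ∸ i) + ∑[ i < suc n ] f i (n ∸ i)  ∎

  ∑-comm-triangle : ∀ n (f : ℕ → ℕ → ℚ) →
    ∑[ i < n ] ∑[ j < n ∸ i ] f i j ≡ ∑[ j < n ] ∑[ i < n ∸ j ] f i j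
  ∑-comm-triangle n f = begin
    ∑[ i < n ] ∑[ j < n ∸ i ] f i j        ≡⟨ ∑-diagonals n f ⟩
    ∑[ t < n ] ∑[ i < suc t ] f i (t ∸ i)  ≡⟨ ∑-cong n (λ t _ → ∑-reverse (suc t) _) ⟩
    ∑[ t < n ] ∑[ i < suc t ] f (t ∸ i) (t ∸ (t ∸ i))
      ≡⟨ ∑-cong n (λ t _ → ∑-cong (suc t) (λ i i≤t → cong (f (t ∸ i)) (ℕ.m∸[m∸n]≡n (ℕ.≤-pred i≤t)))) ⟩
    ∑[ t < n ] ∑[ i < suc t ] f (t ∸ i) i  ≡⟨ ∑-diagonals n (λ j i → f i j) ⟨
    ∑[ j < n ] ∑[ i < n ∸ j ] f i j        ∎

  𝟙 : ∀ {P : Set} → Dec P → ℚ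
  𝟙 (yes _) = 1ℚ
  𝟙 (no _)  = 0ℚ

  𝟙-holds : ∀ {P : Set} (P? : Dec P) → P → 𝟙 P? ≡ 1ℚ
  𝟙-holds (yes _) _  = refl
  𝟙-holds (no ¬p) p  = ⊥-elim (¬p p)

  𝟙-fails : ∀ {P : Set} (P? : Dec P) → ¬ P → 𝟙 P? ≡ 0ℚ
  𝟙-fails (yes p) ¬p = ⊥-elim (¬p p)
  𝟙-fails (no _)  _  = refl

  δ : ℕ → ℕ → ℚ
  δ i k = 𝟙 (i ℕ.≟ k)

  δ-refl : ∀ k → δ k k ≡ 1ℚ
  δ-refl k = 𝟙-holds (k ℕ.≟ k) refl

  δ-≢ : ∀ i k → i ≢ k → δ i k ≡ 0ℚ
  δ-≢ i k = 𝟙-fails (i ℕ.≟ k)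

  ∑-δ : ∀ n k (g : ℕ → ℚ) → k < n → ∑[ i < n ] (δ i k * g i) ≡ g k
  ∑-δ (suc n) k g k≤n with ℕ.m≤n⇒m<n∨m≡n (ℕ.≤-pred k≤n)
  ... | inj₁ k<n = begin
    ∑[ i < n ] (δ i k * g i) + δ n k * g n  ≡⟨ cong₂ _+_ (∑-δ n k g k<n) (cong (_* g n) (δ-≢ n k (ℕ.>⇒≢ k<n))) ⟩
    g k + 0ℚ * g n                          ≡⟨ trans (cong (_+_ (g k)) (*-zeroˡ (g n))) (+-identityʳ (g k)) ⟩
    g k                                     ∎
  ... | inj₂ refl = begin
    ∑[ i < n ] (δ i n * g i) + δ n n * g n  ≡⟨ cong₂ _+_ below-n (cong (_* g n) (δ-refl n)) ⟩
    0ℚ + 1ℚ * g n                           ≡⟨ trans (+-identityˡ _) (*-identityˡ (g n)) ⟩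
    g n                                     ∎
    where
    below-n : ∑[ i < n ] (δ i n * g i) ≡ 0ℚ
    below-n = trans (∑-cong n (λ i i<n → trans (cong (_* g i) (δ-≢ i n (ℕ.<⇒≢ i<n))) (*-zeroˡ (g i)))) (∑-zero n)

  δ-complement : ∀ n j → j ≤ n → δ (suc n ∸ j) 1 ≡ δ j n
  δ-complement n j j≤n with ℕ.m≤n⇒m<n∨m≡n j≤n
  ... | inj₂ refl = trans (cong (λ m → δ m 1) (ℕ.m+n∸n≡m 1 j)) (trans (δ-refl 1) (sym (δ-refl j)))
  ... | inj₁ j<n  = trans (δ-≢ (suc n ∸ j) 1 1+n∸j≢1) (sym (δ-≢ j n (ℕ.<⇒≢ j<n)))
    where
    1+n∸j≢1 : suc n ∸ j ≢ 1
    1+n∸j≢1 eq = ℕ.<⇒≱ j<n (ℕ.m∸n≡0⇒m≤n (ℕ.suc-injective (trans (sym (ℕ.+-∸-assoc 1 (ℕ.<⇒≤ j<n))) eq)))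

  ∑-reindex : ∀ n (σ σ⁻¹ : ℕ → ℕ) →
    (∀ i → i < n → σ i < n) → (∀ j → j < n → σ⁻¹ j < n) →
    (∀ i → i < n → σ⁻¹ (σ i) ≡ i) → (∀ j → j < n → σ (σ⁻¹ j) ≡ j) →
    ∀ f → ∑[ i < n ] f (σ i) ≡ ∑< n f
  ∑-reindex n σ σ⁻¹ σ<n σ⁻¹<n left right f = begin
    ∑[ i < n ] f (σ i)                       ≡⟨ ∑-cong n (λ i i<n → sym (∑-δ n (σ i) f (σ<n i i<n))) ⟩
    ∑[ i < n ] ∑[ j < n ] (δ j (σ i) * f j)  ≡⟨ ∑-comm n n _ ⟩
    ∑[ j < n ] ∑[ i < n ] (δ j (σ i) * f j)  ≡⟨ ∑-cong n (λ j _ → sym (*-distribʳ-∑ n (f j) (λ i → δ j (σ i)))) ⟩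
    ∑[ j < n ] (∑[ i < n ] δ j (σ i) * f j)  ≡⟨ ∑-cong n (λ j j<n → trans (cong (_* f j) (fibre j j<n)) (*-identityˡ (f j))) ⟩
    ∑< n f                                   ∎
    where
    same-δ : ∀ i j → i < n → j < n → δ j (σ i) ≡ δ i (σ⁻¹ j)
    same-δ i j i<n j<n with j ℕ.≟ σ i | i ℕ.≟ σ⁻¹ j
    ... | yes _    | yes _    = refl
    ... | no _     | no _     = refl
    ... | yes j≡σi | no i≢σ⁻¹j = ⊥-elim (i≢σ⁻¹j (trans (sym (left i i<n)) (cong σ⁻¹ (sym j≡σi))))
    ... | no j≢σi  | yes i≡σ⁻¹j = ⊥-elim (j≢σi (trans (sym (right j j<n)) (cong σ (sym i≡σ⁻¹j))))
    fibre : ∀ j → j < n → ∑[ i < n ] δ j (σ i) ≡ 1ℚ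
    fibre j j<n = begin
      ∑[ i < n ] δ j (σ i)           ≡⟨ ∑-cong n (λ i i<n → trans (same-δ i j i<n j<n) (sym (*-identityʳ _))) ⟩
      ∑[ i < n ] (δ i (σ⁻¹ j) * 1ℚ)  ≡⟨ ∑-δ n (σ⁻¹ j) (λ _ → 1ℚ) (σ⁻¹<n j j<n) ⟩
      1ℚ                             ∎

  sumℚ-map-upTo : ∀ n f → sumℚ (map f (upTo n)) ≡ ∑< n f
  sumℚ-map-upTo n f = go n (λ i → i)
    where
    go : ∀ n (g : ℕ → ℕ) → sumℚ (map f (applyUpTo g n)) ≡ ∑[ i < n ] f (g i)
    go zero    g = refl
    go (suc n) g = trans (cong (_+_ (f (g 0))) (go n (g ∘ suc))) (sym (∑-head n (f ∘ g)))

  ι-sumℕ-map-upTo : ∀ n (f : ℕ → ℕ) → ι (sumℕ (map f (upTo n))) ≡ ∑[ i < n ] ι (f i)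
  ι-sumℕ-map-upTo n f = begin
    ι (sumℕ (map f (upTo n)))      ≡⟨ ι-sumℕ (map f (upTo n)) ⟩
    sumℚ (map ι (map f (upTo n)))  ≡⟨ cong sumℚ (sym (map-∘ (upTo n))) ⟩
    sumℚ (map (ι ∘ f) (upTo n))    ≡⟨ sumℚ-map-upTo n (ι ∘ f) ⟩
    ∑[ i < n ] ι (f i)             ∎
    where open import Data.List.Properties using (map-∘)

  sum∘toℕ≡∑ : ∀ n (f : ℕ → ℚ) → sum {n} (f ∘ toℕ) ≡ ∑< n f
  sum∘toℕ≡∑ zero    f = refl
  sum∘toℕ≡∑ (suc n) f = trans (cong (_+_ (f 0)) (sum∘toℕ≡∑ n (f ∘ suc))) (sym (∑-head n f))

  ι-sumℕ-filter : ∀ {P : ℕ → Set} (P? : Decidable P) (f : ℕ → ℕ) xs →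
    ι (sumℕ (map f (filter P? xs))) ≡ sumℚ (map (λ x → 𝟙 (P? x) * ι (f x)) xs)
  ι-sumℕ-filter P? f []       = ι-0
  ι-sumℕ-filter P? f (x ∷ xs) with P? x
  ... | yes _ = trans (ι-+ (f x) _) (cong₂ _+_ (sym (*-identityˡ (ι (f x)))) (ι-sumℕ-filter P? f xs))
  ... | no _  = trans (ι-sumℕ-filter P? f xs) (sym (trans (cong (_+ _) (*-zeroˡ (ι (f x)))) (+-identityˡ _)))

  ∑-naturals : ∀ n → toℚ 2 * ∑[ r < n ] (ι (suc r) ^ℚ 1) ≡ ι n * (ι n + 1ℚ)
  ∑-naturals zero    = trans (*-zeroʳ (toℚ 2)) (sym (trans (cong (_* (ι 0 + 1ℚ)) ι-0) (*-zeroˡ (ι 0 + 1ℚ))))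
  ∑-naturals (suc n) = begin
    toℚ 2 * (∑[ r < n ] (ι (suc r) ^ℚ 1) + ι (suc n) * 1ℚ)
      ≡⟨ *-distribˡ-+ (toℚ 2) (∑[ r < n ] (ι (suc r) ^ℚ 1)) (ι (suc n) * 1ℚ) ⟩
    toℚ 2 * ∑[ r < n ] (ι (suc r) ^ℚ 1) + toℚ 2 * (ι (suc n) * 1ℚ)
      ≡⟨ cong₂ (λ x y → x + toℚ 2 * (y * 1ℚ)) (∑-naturals n) (ι-suc n) ⟩
    ι n * (ι n + 1ℚ) + toℚ 2 * ((ι n + 1ℚ) * 1ℚ)
      ≡⟨ step (ι n) ⟩
    (ι n + 1ℚ) * ((ι n + 1ℚ) + 1ℚ)
      ≡⟨ cong (λ x → x * (x + 1ℚ)) (ι-suc n) ⟨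
    ι (suc n) * (ι (suc n) + 1ℚ)  ∎
    where
    step : ∀ x → x * (x + 1ℚ) + toℚ 2 * ((x + 1ℚ) * 1ℚ) ≡ (x + 1ℚ) * ((x + 1ℚ) + 1ℚ)
    step = Ring.solve-∀ ℚ-ring

  ∑-squares : ∀ n → toℚ 6 * ∑[ r < n ] (ι (suc r) ^ℚ 2) ≡ ι n * (ι n + 1ℚ) * (toℚ 2 * ι n + 1ℚ)
  ∑-squares zero    = trans (*-zeroʳ (toℚ 6)) (sym (trans (cong (λ x → x * (x + 1ℚ) * (toℚ 2 * x + 1ℚ)) ι-0) (*-zeroˡ ((0ℚ + 1ℚ) * (toℚ 2 * 0ℚ + 1ℚ)))))
  ∑-squares (suc n) = begin
    toℚ 6 * (∑[ r < n ] (ι (suc r) ^ℚ 2) + ι (suc n) * (ι (suc n) * 1ℚ))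
      ≡⟨ *-distribˡ-+ (toℚ 6) (∑[ r < n ] (ι (suc r) ^ℚ 2)) (ι (suc n) * (ι (suc n) * 1ℚ)) ⟩
    toℚ 6 * ∑[ r < n ] (ι (suc r) ^ℚ 2) + toℚ 6 * (ι (suc n) * (ι (suc n) * 1ℚ))
      ≡⟨ cong₂ (λ x y → x + toℚ 6 * (y * (y * 1ℚ))) (∑-squares n) (ι-suc n) ⟩
    ι n * (ι n + 1ℚ) * (toℚ 2 * ι n + 1ℚ) + toℚ 6 * ((ι n + 1ℚ) * ((ι n + 1ℚ) * 1ℚ))
      ≡⟨ step (ι n) ⟩
    (ι n + 1ℚ) * ((ι n + 1ℚ) + 1ℚ) * (toℚ 2 * (ι n + 1ℚ) + 1ℚ)
      ≡⟨ cong (λ x → x * (x + 1ℚ) * (toℚ 2 * x + 1ℚ)) (ι-suc n) ⟨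
    ι (suc n) * (ι (suc n) + 1ℚ) * (toℚ 2 * ι (suc n) + 1ℚ)  ∎
    where
    step : ∀ x → x * (x + 1ℚ) * (toℚ 2 * x + 1ℚ) + toℚ 6 * ((x + 1ℚ) * ((x + 1ℚ) * 1ℚ))
                 ≡ (x + 1ℚ) * ((x + 1ℚ) + 1ℚ) * (toℚ 2 * (x + 1ℚ) + 1ℚ)
    step = Ring.solve-∀ ℚ-ring

module BinomialCoefficients where

  open import Data.Nat as ℕ using (ℕ; zero; suc; _≤_; _∸_; _+_; _*_; _/_; _!)
  open import Data.Nat.Properties
  open import Data.Nat.DivMod using (m/n*n≡m)
  open import Data.Nat.Combinatorics using (_C_; nC1≡n; nCk≡nC[n∸k]; nCk≡n!/k![n-k]!; k![n∸k]!∣n!)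
  import Data.Nat.Tactic.RingSolver as ℕ-Ring
  open import Data.Product using (_,_)
  open import Relation.Binary.PropositionalEquality
    using (_≡_; refl; sym; trans; cong; cong₂; subst; module ≡-Reasoning)

  open ≡-Reasoning

  ∸-∸-cancel : ∀ n {κ t} → κ ≤ t → n ∸ κ ∸ (t ∸ κ) ≡ n ∸ t
  ∸-∸-cancel n {κ} κ≤t = trans (∸-+-assoc n κ _) (cong (n ∸_) (m+[n∸m]≡n κ≤t))

  m+[[n∸m]∸o]≡n∸o : ∀ {m o n} → m + o ≤ n → m + (n ∸ m ∸ o) ≡ n ∸ o
  m+[[n∸m]∸o]≡n∸o {m} {o} {n} m+o≤n = begin
    m + (n ∸ m ∸ o)    ≡⟨ cong (_+_ m) (∸-+-assoc n m o) ⟩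
    m + (n ∸ (m + o))  ≡⟨ +-∸-assoc m m+o≤n ⟨
    m + n ∸ (m + o)    ≡⟨ [m+n]∸[m+o]≡n∸o m n o ⟩
    n ∸ o              ∎

  C-! : ∀ k r → ((k + r) C k) * (k ! * r !) ≡ (k + r) !
  C-! k r = begin
    ((k + r) C k) * (k ! * r !)
      ≡⟨ cong (λ m → ((k + r) C k) * (k ! * m !)) (m+n∸m≡n k r) ⟨
    ((k + r) C k) * (k ! * (k + r ∸ k) !)
      ≡⟨ cong (_* (k ! * (k + r ∸ k) !)) (nCk≡n!/k![n-k]! (m≤m+n k r)) ⟩
    (k + r) ! / (k ! * (k + r ∸ k) !) * (k ! * (k + r ∸ k) !)
      ≡⟨ m/n*n≡m (k![n∸k]!∣n! (m≤m+n k r)) ⟩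
    (k + r) !  ∎
    where instance _ = k !* (k + r ∸ k) !≢0

  C-absorb : ∀ κ r → suc (κ + r) * ((κ + r) C κ) ≡ ((κ + suc r) C κ) * suc r
  C-absorb κ r = *-cancelʳ-≡ _ _ (κ ! * r !) {{κ !* r !≢0}} (begin
    suc (κ + r) * ((κ + r) C κ) * (κ ! * r !)    ≡⟨ *-assoc (suc (κ + r)) ((κ + r) C κ) (κ ! * r !) ⟩
    suc (κ + r) * (((κ + r) C κ) * (κ ! * r !))  ≡⟨ cong (suc (κ + r) *_) (C-! κ r) ⟩
    suc (κ + r) !                                ≡⟨ cong _! (+-suc κ r) ⟨
    (κ + suc r) !                                ≡⟨ C-! κ (suc r) ⟨
    ((κ + suc r) C κ) * (κ ! * (suc r * r !))    ≡⟨ shuffle ((κ + suc r) C κ) (κ !) (r !) (suc r) ⟩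
    ((κ + suc r) C κ) * suc r * (κ ! * r !)      ∎)
    where
    shuffle : ∀ c x y s → c * (x * (s * y)) ≡ c * s * (x * y)
    shuffle = ℕ-Ring.solve-∀

  C-trinomial : ∀ κ j r →
    ((κ + (j + r)) C κ) * ((j + r) C j) ≡ ((κ + j + r) C (κ + j)) * ((κ + j) C κ)
  C-trinomial κ j r = *-cancelʳ-≡ _ _ (κ ! * j ! * r !) {{nonZero}} (begin
    ((κ + (j + r)) C κ) * ((j + r) C j) * (κ ! * j ! * r !)
      ≡⟨ regroupˡ ((κ + (j + r)) C κ) ((j + r) C j) (κ !) (j !) (r !) ⟩
    ((κ + (j + r)) C κ) * (κ ! * (((j + r) C j) * (j ! * r !)))
      ≡⟨ cong (λ m → ((κ + (j + r)) C κ) * (κ ! * m)) (C-! j r) ⟩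
    ((κ + (j + r)) C κ) * (κ ! * (j + r) !)
      ≡⟨ C-! κ (j + r) ⟩
    (κ + (j + r)) !
      ≡⟨ cong _! (+-assoc κ j r) ⟨
    (κ + j + r) !
      ≡⟨ C-! (κ + j) r ⟨
    ((κ + j + r) C (κ + j)) * ((κ + j) ! * r !)
      ≡⟨ cong (λ m → ((κ + j + r) C (κ + j)) * (m * r !)) (C-! κ j) ⟨
    ((κ + j + r) C (κ + j)) * (((κ + j) C κ) * (κ ! * j !) * r !)
      ≡⟨ regroupʳ ((κ + j + r) C (κ + j)) ((κ + j) C κ) (κ !) (j !) (r !) ⟩
    ((κ + j + r) C (κ + j)) * ((κ + j) C κ) * (κ ! * j ! * r !)  ∎)
    where
    nonZero : ℕ.NonZero (κ ! * j ! * r !)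
    nonZero = m*n≢0 _ _ {{κ !* j !≢0}} {{r !≢0}}
    regroupˡ : ∀ c d x y z → c * d * (x * y * z) ≡ c * (x * (d * (y * z)))
    regroupˡ = ℕ-Ring.solve-∀
    regroupʳ : ∀ c d x y z → c * (d * (x * y) * z) ≡ c * d * (x * y * z)
    regroupʳ = ℕ-Ring.solve-∀

  C-trinomial-∸ : ∀ {κ t n} → κ ≤ t → t ≤ n → (n C κ) * ((n ∸ κ) C (t ∸ κ)) ≡ (n C t) * (t C κ)
  C-trinomial-∸ {κ} κ≤t t≤n with m≤n⇒∃[o]m+o≡n κ≤t | m≤n⇒∃[o]m+o≡n t≤n
  ... | j , refl | r , refl = begin
    ((κ + j + r) C κ) * ((κ + j + r ∸ κ) C (κ + j ∸ κ))
      ≡⟨ cong₂ (λ m i → (m C κ) * ((m ∸ κ) C i)) (+-assoc κ j r) (m+n∸m≡n κ j) ⟩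
    ((κ + (j + r)) C κ) * ((κ + (j + r) ∸ κ) C j)
      ≡⟨ cong (λ m → ((κ + (j + r)) C κ) * (m C j)) (m+n∸m≡n κ (j + r)) ⟩
    ((κ + (j + r)) C κ) * ((j + r) C j)
      ≡⟨ C-trinomial κ j r ⟩
    ((κ + j + r) C (κ + j)) * ((κ + j) C κ)  ∎

  C-subset-swap : ∀ {κ j n} → κ + j ≤ n → (n C κ) * ((n ∸ κ) C j) ≡ (n C j) * ((n ∸ j) C κ)
  C-subset-swap {κ} {j} {n} κ+j≤n = begin
    (n C κ) * ((n ∸ κ) C j)            ≡⟨ cong (λ i → (n C κ) * ((n ∸ κ) C i)) (m+n∸m≡n κ j) ⟨
    (n C κ) * ((n ∸ κ) C (κ + j ∸ κ))  ≡⟨ C-trinomial-∸ (m≤m+n κ j) κ+j≤n ⟩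
    (n C (κ + j)) * ((κ + j) C κ)      ≡⟨ cong₂ _*_ (cong (n C_) (+-comm κ j)) (symmetric κ j) ⟩
    (n C (j + κ)) * ((j + κ) C j)      ≡⟨ C-trinomial-∸ (m≤m+n j κ) (subst (_≤ n) (+-comm κ j) κ+j≤n) ⟨
    (n C j) * ((n ∸ j) C (j + κ ∸ j))  ≡⟨ cong (λ i → (n C j) * ((n ∸ j) C i)) (m+n∸m≡n j κ) ⟩
    (n C j) * ((n ∸ j) C κ)            ∎
    where
    symmetric : ∀ κ j → (κ + j) C κ ≡ (j + κ) C j
    symmetric κ j = begin
      (κ + j) C κ            ≡⟨ nCk≡nC[n∸k] (m≤m+n κ j) ⟩
      (κ + j) C (κ + j ∸ κ)  ≡⟨ cong₂ _C_ (+-comm κ j) (m+n∸m≡n κ j) ⟩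
      (j + κ) C j            ∎

  C-absorb-∸ : ∀ {κ n} → κ ≤ n → suc n * (n C κ) ≡ (suc n C κ) * suc (n ∸ κ)
  C-absorb-∸ {κ} κ≤n with m≤n⇒∃[o]m+o≡n κ≤n
  ... | r , refl = begin
    suc (κ + r) * ((κ + r) C κ)          ≡⟨ C-absorb κ r ⟩
    ((κ + suc r) C κ) * suc r            ≡⟨ cong₂ (λ m i → (m C κ) * suc i) (sym (+-suc κ r)) (m+n∸m≡n κ r) ⟨
    (suc (κ + r) C κ) * suc (κ + r ∸ κ)  ∎

  [n+1]Cn≡n+1 : ∀ n → suc n C n ≡ suc n
  [n+1]Cn≡n+1 n = begin
    suc n C n            ≡⟨ nCk≡nC[n∸k] (n≤1+n n) ⟩
    suc n C (suc n ∸ n)  ≡⟨ cong (suc n C_) (m+n∸n≡m 1 n) ⟩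
    suc n C 1            ≡⟨ nC1≡n (suc n) ⟩
    suc n                ∎

module Bernoulli where

  open Cast
  open FiniteSums
  open BinomialCoefficients
  open import Data.Nat as ℕ using (ℕ; zero; suc; _≤_; _<_; _∸_; z≤n; s≤s)
  import Data.Nat.Properties as ℕ
  open import Data.Nat.Combinatorics using (_C_; nCn≡1; nC1≡n)
  open import Data.List using (List; []; _∷_; _++_; [_]; map; upTo; zipWith)
  import Data.List.Properties as List
  open import Data.Rational using (ℚ; 0ℚ; 1ℚ; _+_; _*_; _-_; -_)
  open import Data.Rational.Properties
  open import Function using (_∘_)
  open import Relation.Binary.PropositionalEquality
    using (_≡_; refl; sym; trans; cong; cong₂; subst; module ≡-Reasoning)
  open import Algebra.Bundles using (CommutativeRing)
  open import Algebra.Properties.CommutativeSemiring.Binomial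
    (CommutativeRing.commutativeSemiring +-*-commutativeRing) using (theorem; binomialExpansion)
  import Algebra.Definitions.RawMonoid (CommutativeRing.+-rawMonoid +-*-commutativeRing) as Additive
  import Tactic.RingSolver as Ring

  open ≡-Reasoning

  ×≡ι* : ∀ n x → n Additive.× x ≡ ι n * x
  ×≡ι* zero    x = trans (sym (*-zeroˡ x)) (cong (_* x) (sym ι-0))
  ×≡ι* (suc n) x = begin
    x + n Additive.× x  ≡⟨ cong (_+_ x) (×≡ι* n x) ⟩
    x + ι n * x         ≡⟨ cong (_+ ι n * x) (*-identityˡ x) ⟨
    1ℚ * x + ι n * x    ≡⟨ *-distribʳ-+ x 1ℚ (ι n) ⟨
    (1ℚ + ι n) * x      ≡⟨ cong (λ y → (y + ι n) * x) ι-1 ⟨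
    (ι 1 + ι n) * x     ≡⟨ cong (_* x) (ι-+ 1 n) ⟨
    ι (suc n) * x       ∎

  binomial-theorem : ∀ n x y → (x + y) ^ℚ n ≡ ∑[ k < suc n ] (ι (n C k) * (x ^ℚ k * y ^ℚ (n ∸ k)))
  binomial-theorem n x y = begin
    (x + y) ^ℚ n                                                 ≡⟨ theorem n x y ⟩
    binomialExpansion x y n                                      ≡⟨ sum∘toℕ≡∑ (suc n) (λ k → (n C k) Additive.× (x ^ℚ k * y ^ℚ (n ∸ k))) ⟩
    ∑[ k < suc n ] ((n C k) Additive.× (x ^ℚ k * y ^ℚ (n ∸ k)))  ≡⟨ ∑-cong (suc n) (λ k _ → ×≡ι* (n C k) _) ⟩
    ∑[ k < suc n ] (ι (n C k) * (x ^ℚ k * y ^ℚ (n ∸ k)))         ∎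

  B : ℕ → ℚ
  B = bernoulli

  Bs≡map-upTo : ∀ n → Bs n ≡ map B (upTo n)
  Bs≡map-upTo zero    = refl
  Bs≡map-upTo (suc n) = begin
    Bs n ++ [ newB n (Bs n) ]                      ≡⟨ cong (λ l → l ++ [ newB n l ]) (Bs≡map-upTo n) ⟩
    map B (upTo n) ++ [ newB n (map B (upTo n)) ]  ≡⟨ cong (λ l → map B (upTo n) ++ [ newB n l ]) (Bs≡map-upTo n) ⟨
    map B (upTo n) ++ map B [ n ]                  ≡⟨ List.map-++ B (upTo n) [ n ] ⟨
    map B (upTo n ++ [ n ])                        ≡⟨ cong (map B) (List.upTo-∷ʳ n) ⟩
    map B (upTo (suc n))                           ∎

  B-suc : ∀ m → B (suc m) ≡ - ((∑[ k < suc m ] (ι (suc (suc m) C k) * B k)) ÷ℕ suc (suc m))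
  B-suc m = cong (λ z → - (z ÷ℕ suc (suc m))) (begin
    sumℚ (zipWith term (upTo (suc m)) (Bs (suc m)))            ≡⟨ cong (sumℚ ∘ zipWith term (upTo (suc m))) (Bs≡map-upTo (suc m)) ⟩
    sumℚ (zipWith term (upTo (suc m)) (map B (upTo (suc m))))  ≡⟨ cong sumℚ (zipWith-map-diagonal (upTo (suc m))) ⟩
    sumℚ (map (λ k → term k (B k)) (upTo (suc m)))             ≡⟨ sumℚ-map-upTo (suc m) (λ k → term k (B k)) ⟩
    ∑[ k < suc m ] term k (B k)                                ≡⟨ ∑-cong (suc m) (λ k _ → cong (λ f → f (suc (suc m) C k) * B k) (sym ι≡toℚ)) ⟩
    ∑[ k < suc m ] (ι (suc (suc m) C k) * B k)                 ∎)
    where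
    term : ℕ → ℚ → ℚ
    term k b = toℚ (suc (suc m) C k) * b
    zipWith-map-diagonal : ∀ ks → zipWith term ks (map B ks) ≡ map (λ k → term k (B k)) ks
    zipWith-map-diagonal []       = refl
    zipWith-map-diagonal (k ∷ ks) = cong (term k (B k) ∷_) (zipWith-map-diagonal ks)

  bernoulli-recurrence : ∀ t → ∑[ κ < t ] (ι (t C κ) * B κ) ≡ δ t 1
  bernoulli-recurrence zero          = sym (δ-≢ 0 1 (λ ()))
  bernoulli-recurrence (suc zero)    = trans (+-identityˡ _) (trans (cong (_* 1ℚ) ι-1) (sym (δ-refl 1)))
  bernoulli-recurrence (suc (suc m)) = begin
    S + ι (suc (suc m) C suc m) * B (suc m)     ≡⟨ cong₂ (λ c b → S + ι c * b) ([n+1]Cn≡n+1 (suc m)) (B-suc m) ⟩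
    S + ι (suc (suc m)) * - (S ÷ℕ suc (suc m))  ≡⟨ move (S ÷ℕ suc (suc m)) (ι (suc (suc m))) S ⟩
    S - S ÷ℕ suc (suc m) * ι (suc (suc m))      ≡⟨ cong (λ y → S - y) (÷ℕ-*-cancel S (suc (suc m))) ⟩
    S - S                                       ≡⟨ +-inverseʳ S ⟩
    0ℚ                                          ≡⟨ δ-≢ (suc (suc m)) 1 (λ ()) ⟨
    δ (suc (suc m)) 1                           ∎
    where
    S = ∑[ k < suc m ] (ι (suc (suc m) C k) * B k)
    move : ∀ y i s → s + i * - y ≡ s - y * i
    move = Ring.solve-∀ ℚ-ring

  bernoulli-recurrence-full : ∀ t → ∑[ κ < suc t ] (ι (t C κ) * B κ) ≡ δ t 1 + B t
  bernoulli-recurrence-full t =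
    cong₂ _+_ (bernoulli-recurrence t) (trans (cong (λ c → ι c * B t) (nCn≡1 t)) (trans (cong (_* B t) ι-1) (*-identityˡ (B t))))

  -- The homogenised Bernoulli polynomial aⁿ Bₙ(x / a).
  bernoulliPoly : ℕ → ℚ → ℚ → ℚ
  bernoulliPoly n a x = ∑[ κ < suc n ] (ι (n C κ) * B κ * a ^ℚ κ * x ^ℚ (n ∸ κ))

  bernoulliPoly-translate : ∀ n a x →
    bernoulliPoly n a (x + a)
      ≡ ∑[ t < suc n ] (ι (n C t) * a ^ℚ t * x ^ℚ (n ∸ t) * ∑[ κ < suc t ] (ι (t C κ) * B κ))
  bernoulliPoly-translate n a x = begin
    bernoulliPoly n a (x + a)
      ≡⟨ ∑-cong (suc n) (λ κ κ≤n → expand κ (ℕ.≤-pred κ≤n)) ⟩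
    ∑[ κ < suc n ] ∑[ j < suc n ∸ κ ] G κ j
      ≡⟨ ∑-diagonals (suc n) G ⟩
    ∑[ t < suc n ] ∑[ κ < suc t ] G κ (t ∸ κ)
      ≡⟨ ∑-cong (suc n) (λ t t≤n → ∑-cong (suc t) (λ κ κ≤t → regroup t κ (ℕ.≤-pred κ≤t) (ℕ.≤-pred t≤n))) ⟩
    ∑[ t < suc n ] ∑[ κ < suc t ] (D t * (ι (t C κ) * B κ))
      ≡⟨ ∑-cong (suc n) (λ t _ → sym (*-distribˡ-∑ (suc t) (D t) _)) ⟩
    ∑[ t < suc n ] (D t * ∑[ κ < suc t ] (ι (t C κ) * B κ))  ∎
    where
    c : ℕ → ℚ
    c κ = ι (n C κ) * B κ * a ^ℚ κ
    D : ℕ → ℚ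
    D t = ι (n C t) * a ^ℚ t * x ^ℚ (n ∸ t)
    G : ℕ → ℕ → ℚ
    G κ j = c κ * (ι ((n ∸ κ) C j) * (a ^ℚ j * x ^ℚ (n ∸ κ ∸ j)))
    expand : ∀ κ → κ ≤ n → c κ * (x + a) ^ℚ (n ∸ κ) ≡ ∑[ j < suc n ∸ κ ] G κ j
    expand κ κ≤n = begin
      c κ * (x + a) ^ℚ (n ∸ κ)
        ≡⟨ cong (λ y → c κ * y ^ℚ (n ∸ κ)) (+-comm x a) ⟩
      c κ * (a + x) ^ℚ (n ∸ κ)
        ≡⟨ cong (c κ *_) (binomial-theorem (n ∸ κ) a x) ⟩
      c κ * ∑[ j < suc (n ∸ κ) ] (ι ((n ∸ κ) C j) * (a ^ℚ j * x ^ℚ (n ∸ κ ∸ j)))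
        ≡⟨ *-distribˡ-∑ (suc (n ∸ κ)) (c κ) _ ⟩
      ∑[ j < suc (n ∸ κ) ] G κ j
        ≡⟨ cong (λ m → ∑< m (G κ)) (ℕ.+-∸-assoc 1 κ≤n) ⟨
      ∑[ j < suc n ∸ κ ] G κ j  ∎
    regroup : ∀ t κ → κ ≤ t → t ≤ n → G κ (t ∸ κ) ≡ D t * (ι (t C κ) * B κ)
    regroup t κ κ≤t t≤n = begin
      c κ * (ι ((n ∸ κ) C (t ∸ κ)) * (a ^ℚ (t ∸ κ) * x ^ℚ (n ∸ κ ∸ (t ∸ κ))))
        ≡⟨ collect (ι (n C κ)) (B κ) (a ^ℚ κ) (ι ((n ∸ κ) C (t ∸ κ))) (a ^ℚ (t ∸ κ)) (x ^ℚ (n ∸ κ ∸ (t ∸ κ))) ⟩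
      ι (n C κ) * ι ((n ∸ κ) C (t ∸ κ)) * B κ * (a ^ℚ κ * a ^ℚ (t ∸ κ)) * x ^ℚ (n ∸ κ ∸ (t ∸ κ))
        ≡⟨ cong₂ (λ u v → u * B κ * (a ^ℚ κ * a ^ℚ (t ∸ κ)) * x ^ℚ v) coefficients (∸-∸-cancel n κ≤t) ⟩
      ι (n C t) * ι (t C κ) * B κ * (a ^ℚ κ * a ^ℚ (t ∸ κ)) * x ^ℚ (n ∸ t)
        ≡⟨ cong (λ u → ι (n C t) * ι (t C κ) * B κ * u * x ^ℚ (n ∸ t)) (trans (sym (^-homo-* a κ (t ∸ κ))) (cong (a ^ℚ_) (ℕ.m+[n∸m]≡n κ≤t))) ⟩
      ι (n C t) * ι (t C κ) * B κ * a ^ℚ t * x ^ℚ (n ∸ t)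
        ≡⟨ distribute (ι (n C t)) (ι (t C κ)) (B κ) (a ^ℚ t) (x ^ℚ (n ∸ t)) ⟩
      D t * (ι (t C κ) * B κ)  ∎
      where
      coefficients : ι (n C κ) * ι ((n ∸ κ) C (t ∸ κ)) ≡ ι (n C t) * ι (t C κ)
      coefficients = trans (sym (ι-* (n C κ) _)) (trans (cong ι (C-trinomial-∸ κ≤t t≤n)) (ι-* (n C t) (t C κ)))
      collect : ∀ c b p d q y → c * b * p * (d * (q * y)) ≡ c * d * b * (p * q) * y
      collect = Ring.solve-∀ ℚ-ring
      distribute : ∀ c d b p y → c * d * b * p * y ≡ c * p * y * (d * b)
      distribute = Ring.solve-∀ ℚ-ring

  bernoulliPoly-shift : ∀ n a x →
    bernoulliPoly (suc n) a (x + a) ≡ bernoulliPoly (suc n) a x + ι (suc n) * (a * x ^ℚ n)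
  bernoulliPoly-shift n a x = begin
    bernoulliPoly N a (x + a)
      ≡⟨ bernoulliPoly-translate N a x ⟩
    ∑[ t < suc N ] (D t * ∑[ κ < suc t ] (ι (t C κ) * B κ))
      ≡⟨ ∑-cong (suc N) (λ t _ → trans (cong (D t *_) (bernoulli-recurrence-full t)) (split (D t) (δ t 1) (B t))) ⟩
    ∑[ t < suc N ] (D t * B t + δ t 1 * D t)
      ≡⟨ ∑-distrib-+ (suc N) _ _ ⟩
    ∑[ t < suc N ] (D t * B t) + ∑[ t < suc N ] (δ t 1 * D t)
      ≡⟨ cong₂ _+_ (∑-cong (suc N) (λ t _ → reorder (ι (N C t)) (B t) (a ^ℚ t) (x ^ℚ (N ∸ t)))) (∑-δ (suc N) 1 D (s≤s (s≤s z≤n))) ⟩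
    bernoulliPoly N a x + ι (N C 1) * a ^ℚ 1 * x ^ℚ n
      ≡⟨ cong₂ (λ c y → bernoulliPoly N a x + ι c * y * x ^ℚ n) (nC1≡n N) (*-identityʳ a) ⟩
    bernoulliPoly N a x + ι N * a * x ^ℚ n
      ≡⟨ cong (_+_ (bernoulliPoly N a x)) (*-assoc (ι N) a (x ^ℚ n)) ⟩
    bernoulliPoly N a x + ι N * (a * x ^ℚ n)  ∎
    where
    N = suc n
    D : ℕ → ℚ
    D t = ι (N C t) * a ^ℚ t * x ^ℚ (N ∸ t)
    split : ∀ d e b → d * (e + b) ≡ d * b + e * d
    split = Ring.solve-∀ ℚ-ring
    reorder : ∀ c b p y → c * p * y * b ≡ c * b * p * y
    reorder = Ring.solve-∀ ℚ-ring

  bernoulliPoly-0 : ∀ n a → bernoulliPoly n a 0ℚ ≡ B n * a ^ℚ n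
  bernoulliPoly-0 n a = begin
    bernoulliPoly n a 0ℚ                      ≡⟨ ∑-last n _ (λ κ κ<n → below-n κ κ<n) ⟩
    ι (n C n) * B n * a ^ℚ n * 0ℚ ^ℚ (n ∸ n)  ≡⟨ cong₂ (λ c e → ι c * B n * a ^ℚ n * 0ℚ ^ℚ e) (nCn≡1 n) (ℕ.n∸n≡0 n) ⟩
    ι 1 * B n * a ^ℚ n * 1ℚ                   ≡⟨ cong (λ y → y * B n * a ^ℚ n * 1ℚ) ι-1 ⟩
    1ℚ * B n * a ^ℚ n * 1ℚ                    ≡⟨ simplify (B n) (a ^ℚ n) ⟩
    B n * a ^ℚ n                              ∎
    where
    below-n : ∀ κ → κ < n → ι (n C κ) * B κ * a ^ℚ κ * 0ℚ ^ℚ (n ∸ κ) ≡ 0ℚ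
    below-n κ κ<n = begin
      ι (n C κ) * B κ * a ^ℚ κ * 0ℚ ^ℚ (n ∸ κ)             ≡⟨ cong (λ e → ι (n C κ) * B κ * a ^ℚ κ * 0ℚ ^ℚ e) (ℕ.+-∸-assoc 1 κ<n) ⟩
      ι (n C κ) * B κ * a ^ℚ κ * (0ℚ * 0ℚ ^ℚ (n ∸ suc κ))  ≡⟨ cong (ι (n C κ) * B κ * a ^ℚ κ *_) (*-zeroˡ (0ℚ ^ℚ (n ∸ suc κ))) ⟩
      ι (n C κ) * B κ * a ^ℚ κ * 0ℚ                        ≡⟨ *-zeroʳ (ι (n C κ) * B κ * a ^ℚ κ) ⟩
      0ℚ                                                   ∎
    simplify : ∀ b p → 1ℚ * b * p * 1ℚ ≡ b * p
    simplify = Ring.solve-∀ ℚ-ring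

  bernoulliPoly-∑-progression : ∀ μ a x q →
    ι (suc μ) * (a * ∑[ k < q ] ((x + ι k * a) ^ℚ μ))
      ≡ bernoulliPoly (suc μ) a (x + ι q * a) - bernoulliPoly (suc μ) a x
  bernoulliPoly-∑-progression μ a x q = begin
    ι (suc μ) * (a * ∑[ k < q ] ((x + ι k * a) ^ℚ μ))
      ≡⟨ cong (ι (suc μ) *_) (*-distribˡ-∑ q a _) ⟩
    ι (suc μ) * ∑[ k < q ] (a * (x + ι k * a) ^ℚ μ)
      ≡⟨ *-distribˡ-∑ q (ι (suc μ)) _ ⟩
    ∑[ k < q ] (ι (suc μ) * (a * (x + ι k * a) ^ℚ μ))
      ≡⟨ ∑-cong q (λ k _ → step k) ⟩
    ∑[ k < q ] (P (x + ι (suc k) * a) - P (x + ι k * a))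
      ≡⟨ ∑-telescope q (λ k → P (x + ι k * a)) ⟩
    P (x + ι q * a) - P (x + ι 0 * a)
      ≡⟨ cong (λ y → P (x + ι q * a) - P y) (trans (cong (λ i → x + i * a) ι-0) (trans (cong (_+_ x) (*-zeroˡ a)) (+-identityʳ x))) ⟩
    P (x + ι q * a) - P x  ∎
    where
    P = bernoulliPoly (suc μ) a
    step : ∀ k → ι (suc μ) * (a * (x + ι k * a) ^ℚ μ) ≡ P (x + ι (suc k) * a) - P (x + ι k * a)
    step k = begin
      ι (suc μ) * (a * y ^ℚ μ)                ≡⟨ isolate (P y) (ι (suc μ) * (a * y ^ℚ μ)) ⟩
      (P y + ι (suc μ) * (a * y ^ℚ μ)) - P y  ≡⟨ cong (_- P y) (bernoulliPoly-shift μ a y) ⟨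
      P (y + a) - P y                         ≡⟨ cong (λ z → P z - P y) next ⟩
      P (x + ι (suc k) * a) - P y             ∎
      where
      y = x + ι k * a
      isolate : ∀ p d → d ≡ (p + d) - p
      isolate = Ring.solve-∀ ℚ-ring
      next : y + a ≡ x + ι (suc k) * a
      next = trans (step-right x (ι k) a) (cong (λ i → x + i * a) (sym (ι-suc k)))
        where
        step-right : ∀ x i a → x + i * a + a ≡ x + (i + 1ℚ) * a
        step-right = Ring.solve-∀ ℚ-ring

  faulhaber : ∀ p A →
    ι (suc p) * ∑[ ρ < A ] (ι ρ ^ℚ p) ≡ ∑[ j < suc p ] (ι (suc p C j) * B j * ι A ^ℚ (suc p ∸ j))
  faulhaber p A = begin
    ι (suc p) * ∑[ ρ < A ] (ι ρ ^ℚ p)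
      ≡⟨ cong (ι (suc p) *_) (trans (∑-cong A (λ k _ → cong (_^ℚ p) (unit-progression (ι k)))) (sym (*-identityˡ _))) ⟩
    ι (suc p) * (1ℚ * ∑[ k < A ] ((0ℚ + ι k * 1ℚ) ^ℚ p))
      ≡⟨ bernoulliPoly-∑-progression p 1ℚ 0ℚ A ⟩
    P (0ℚ + ι A * 1ℚ) - P 0ℚ
      ≡⟨ cong₂ (λ y z → P y - z) (sym (unit-progression (ι A))) (trans (bernoulliPoly-0 (suc p) 1ℚ) (cong (B (suc p) *_) (1^ℚ (suc p)))) ⟩
    (∑[ j < suc p ] term j + term (suc p)) - B (suc p) * 1ℚ
      ≡⟨ cong (λ t → (∑[ j < suc p ] term j + t) - B (suc p) * 1ℚ) top-term ⟩
    (∑[ j < suc p ] term j + B (suc p)) - B (suc p) * 1ℚ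
      ≡⟨ cancel (∑[ j < suc p ] term j) (B (suc p)) ⟩
    ∑[ j < suc p ] term j
      ≡⟨ ∑-cong (suc p) (λ j _ → cong (λ u → ι (suc p C j) * B j * u * ι A ^ℚ (suc p ∸ j)) (1^ℚ j)) ⟩
    ∑[ j < suc p ] (ι (suc p C j) * B j * 1ℚ * ι A ^ℚ (suc p ∸ j))
      ≡⟨ ∑-cong (suc p) (λ j _ → cong (_* ι A ^ℚ (suc p ∸ j)) (*-identityʳ (ι (suc p C j) * B j))) ⟩
    ∑[ j < suc p ] (ι (suc p C j) * B j * ι A ^ℚ (suc p ∸ j))  ∎
    where
    P = bernoulliPoly (suc p) 1ℚ
    term : ℕ → ℚ
    term j = ι (suc p C j) * B j * 1ℚ ^ℚ j * ι A ^ℚ (suc p ∸ j)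
    unit-progression : ∀ y → y ≡ 0ℚ + y * 1ℚ
    unit-progression = Ring.solve-∀ ℚ-ring
    top-term : term (suc p) ≡ B (suc p)
    top-term = begin
      ι (suc p C suc p) * B (suc p) * 1ℚ ^ℚ suc p * ι A ^ℚ (suc p ∸ suc p)
        ≡⟨ cong₂ (λ c e → ι c * B (suc p) * e * ι A ^ℚ (suc p ∸ suc p)) (nCn≡1 (suc p)) (1^ℚ (suc p)) ⟩
      ι 1 * B (suc p) * 1ℚ * ι A ^ℚ (p ∸ p)
        ≡⟨ cong₂ (λ i e → i * B (suc p) * 1ℚ * ι A ^ℚ e) ι-1 (ℕ.n∸n≡0 p) ⟩
      1ℚ * B (suc p) * 1ℚ * 1ℚ
        ≡⟨ units (B (suc p)) ⟩
      B (suc p)  ∎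
      where
      units : ∀ b → 1ℚ * b * 1ℚ * 1ℚ ≡ b
      units = Ring.solve-∀ ℚ-ring
    cancel : ∀ s b → (s + b) - b * 1ℚ ≡ s
    cancel = Ring.solve-∀ ℚ-ring

  ∑-bernoulliPoly : ∀ n m A (w : ℕ → ℚ) →
    ∑[ t < m ] bernoulliPoly n A (w t) ≡ ∑[ κ < suc n ] (ι (n C κ) * B κ * A ^ℚ κ * ∑[ t < m ] (w t ^ℚ (n ∸ κ)))
  ∑-bernoulliPoly n m A w = begin
    ∑[ t < m ] ∑[ κ < suc n ] (c κ * w t ^ℚ (n ∸ κ))    ≡⟨ ∑-comm m (suc n) _ ⟩
    ∑[ κ < suc n ] ∑[ t < m ] (c κ * w t ^ℚ (n ∸ κ))    ≡⟨ ∑-cong (suc n) (λ κ _ → sym (*-distribˡ-∑ m (c κ) _)) ⟩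
    ∑[ κ < suc n ] (c κ * ∑[ t < m ] (w t ^ℚ (n ∸ κ)))  ∎
    where
    c : ℕ → ℚ
    c κ = ι (n C κ) * B κ * A ^ℚ κ

  ∑-bernoulliPoly-top : ∀ n m A (w : ℕ → ℚ) →
    ∑[ t < m ] bernoulliPoly n A (w t)
      ≡ ∑[ κ < n ] (ι (n C κ) * B κ * A ^ℚ κ * ∑[ t < m ] (w t ^ℚ (n ∸ κ))) + ι m * (B n * A ^ℚ n)
  ∑-bernoulliPoly-top n m A w = trans (∑-bernoulliPoly n m A w) (cong (_+_ (∑[ κ < n ] (c κ * ∑[ t < m ] (w t ^ℚ (n ∸ κ))))) top-term)
    where
    c : ℕ → ℚ
    c κ = ι (n C κ) * B κ * A ^ℚ κ
    top-term : c n * ∑[ t < m ] (w t ^ℚ (n ∸ n)) ≡ ι m * (B n * A ^ℚ n)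
    top-term = begin
      c n * ∑[ t < m ] (w t ^ℚ (n ∸ n))   ≡⟨ cong₂ (λ k e → ι k * B n * A ^ℚ n * ∑[ t < m ] (w t ^ℚ e)) (nCn≡1 n) (ℕ.n∸n≡0 n) ⟩
      ι 1 * B n * A ^ℚ n * ∑[ t < m ] 1ℚ  ≡⟨ cong₂ (λ i s → i * B n * A ^ℚ n * s) ι-1 (∑-const m 1ℚ) ⟩
      1ℚ * B n * A ^ℚ n * (ι m * 1ℚ)      ≡⟨ simplify (B n) (A ^ℚ n) (ι m) ⟩
      ι m * (B n * A ^ℚ n)                ∎
      where
      simplify : ∀ b p m → 1ℚ * b * p * (m * 1ℚ) ≡ m * (b * p)
      simplify = Ring.solve-∀ ℚ-ring

  bernoulliPoly-raabe : ∀ n a → ∑[ ρ < a ] bernoulliPoly n (ι a) (ι ρ) ≡ ι a * B n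
  bernoulliPoly-raabe n a = ι-*-cancelˡ N (begin
    ι N * ∑[ ρ < a ] bernoulliPoly n A (ι ρ)
      ≡⟨ cong (ι N *_) (∑-bernoulliPoly n a A ι) ⟩
    ι N * ∑[ κ < N ] (c κ * S (n ∸ κ))
      ≡⟨ *-distribˡ-∑ N (ι N) _ ⟩
    ∑[ κ < N ] (ι N * (c κ * S (n ∸ κ)))
      ≡⟨ ∑-cong N (λ κ κ<N → by-faulhaber κ (ℕ.≤-pred κ<N)) ⟩
    ∑[ κ < N ] (E κ * ∑[ j < N ∸ κ ] F (N ∸ κ) j)
      ≡⟨ ∑-cong N (λ κ _ → *-distribˡ-∑ (N ∸ κ) (E κ) _) ⟩
    ∑[ κ < N ] ∑[ j < N ∸ κ ] (E κ * F (N ∸ κ) j)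
      ≡⟨ ∑-cong N (λ κ κ<N → ∑-cong (N ∸ κ) (λ j j<N∸κ → swap-subsets κ j (κ+j≤N κ j κ<N j<N∸κ))) ⟩
    ∑[ κ < N ] ∑[ j < N ∸ κ ] H j κ
      ≡⟨ ∑-comm-triangle N (λ κ j → H j κ) ⟩
    ∑[ j < N ] ∑[ κ < N ∸ j ] H j κ
      ≡⟨ ∑-cong N (λ j _ → sym (*-distribˡ-∑ (N ∸ j) (F N j) _)) ⟩
    ∑[ j < N ] (F N j * ∑[ κ < N ∸ j ] (ι ((N ∸ j) C κ) * B κ))
      ≡⟨ ∑-cong N (λ j j≤n → trans (cong (F N j *_) (bernoulli-recurrence (N ∸ j))) (*-comm (F N j) _)) ⟩
    ∑[ j < N ] (δ (N ∸ j) 1 * F N j)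
      ≡⟨ ∑-cong N (λ j j≤n → cong (_* F N j) (δ-complement n j (ℕ.≤-pred j≤n))) ⟩
    ∑[ j < N ] (δ j n * F N j)
      ≡⟨ ∑-δ N n (F N) (ℕ.n<1+n n) ⟩
    ι (N C n) * B n * A ^ℚ (N ∸ n)
      ≡⟨ cong₂ (λ c e → ι c * B n * A ^ℚ e) ([n+1]Cn≡n+1 n) (ℕ.m+n∸n≡m 1 n) ⟩
    ι N * B n * (A * 1ℚ)
      ≡⟨ rearrange (ι N) (B n) A ⟩
    ι N * (A * B n)  ∎)
    where
    N = suc n
    A = ι a
    c : ℕ → ℚ
    c κ = ι (n C κ) * B κ * A ^ℚ κ
    E : ℕ → ℚ
    E κ = ι (N C κ) * B κ * A ^ℚ κ
    S : ℕ → ℚ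
    S p = ∑[ ρ < a ] (ι ρ ^ℚ p)
    F : ℕ → ℕ → ℚ
    F m j = ι (m C j) * B j * A ^ℚ (m ∸ j)
    H : ℕ → ℕ → ℚ
    H j κ = F N j * (ι ((N ∸ j) C κ) * B κ)

    by-faulhaber : ∀ κ → κ ≤ n → ι N * (c κ * S (n ∸ κ)) ≡ E κ * ∑[ j < N ∸ κ ] F (N ∸ κ) j
    by-faulhaber κ κ≤n = begin
      ι N * (c κ * S (n ∸ κ))
        ≡⟨ regroup (ι N) (ι (n C κ)) (B κ) (A ^ℚ κ) (S (n ∸ κ)) ⟩
      (ι N * ι (n C κ)) * (B κ * A ^ℚ κ * S (n ∸ κ))
        ≡⟨ cong (_* (B κ * A ^ℚ κ * S (n ∸ κ))) absorb ⟩
      (ι (N C κ) * ι (suc (n ∸ κ))) * (B κ * A ^ℚ κ * S (n ∸ κ))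
        ≡⟨ regroup′ (ι (N C κ)) (ι (suc (n ∸ κ))) (B κ) (A ^ℚ κ) (S (n ∸ κ)) ⟩
      E κ * (ι (suc (n ∸ κ)) * S (n ∸ κ))
        ≡⟨ cong (E κ *_) (faulhaber (n ∸ κ) a) ⟩
      E κ * ∑[ j < suc (n ∸ κ) ] F (suc (n ∸ κ)) j
        ≡⟨ cong (λ m → E κ * ∑[ j < m ] F m j) (ℕ.+-∸-assoc 1 κ≤n) ⟨
      E κ * ∑[ j < N ∸ κ ] F (N ∸ κ) j  ∎
      where
      absorb : ι N * ι (n C κ) ≡ ι (N C κ) * ι (suc (n ∸ κ))
      absorb = trans (sym (ι-* N (n C κ))) (trans (cong ι (C-absorb-∸ κ≤n)) (ι-* (N C κ) (suc (n ∸ κ))))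
      regroup : ∀ m c b p s → m * (c * b * p * s) ≡ (m * c) * (b * p * s)
      regroup = Ring.solve-∀ ℚ-ring
      regroup′ : ∀ c m b p s → (c * m) * (b * p * s) ≡ c * b * p * (m * s)
      regroup′ = Ring.solve-∀ ℚ-ring

    κ+j≤N : ∀ κ j → κ < N → j < N ∸ κ → κ ℕ.+ j ≤ N
    κ+j≤N κ j κ<N j<N∸κ = subst (_≤ N) (ℕ.+-comm j κ) (ℕ.m≤o∸n⇒m+n≤o j (ℕ.<⇒≤ κ<N) (ℕ.<⇒≤ j<N∸κ))

    swap-subsets : ∀ κ j → κ ℕ.+ j ≤ N → E κ * F (N ∸ κ) j ≡ H j κ
    swap-subsets κ j κ+j≤N = begin
      E κ * F (N ∸ κ) j
        ≡⟨ collect (ι (N C κ)) (B κ) (A ^ℚ κ) (ι ((N ∸ κ) C j)) (B j) (A ^ℚ (N ∸ κ ∸ j)) ⟩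
      (ι (N C κ) * ι ((N ∸ κ) C j)) * B κ * B j * (A ^ℚ κ * A ^ℚ (N ∸ κ ∸ j))
        ≡⟨ cong₂ (λ u v → u * B κ * B j * v) coefficients powers ⟩
      (ι (N C j) * ι ((N ∸ j) C κ)) * B κ * B j * A ^ℚ (N ∸ j)
        ≡⟨ distribute (ι (N C j)) (ι ((N ∸ j) C κ)) (B κ) (B j) (A ^ℚ (N ∸ j)) ⟩
      H j κ  ∎
      where
      coefficients : ι (N C κ) * ι ((N ∸ κ) C j) ≡ ι (N C j) * ι ((N ∸ j) C κ)
      coefficients = trans (sym (ι-* (N C κ) ((N ∸ κ) C j))) (trans (cong ι (C-subset-swap {κ} {j} κ+j≤N)) (ι-* (N C j) ((N ∸ j) C κ)))
      powers : A ^ℚ κ * A ^ℚ (N ∸ κ ∸ j) ≡ A ^ℚ (N ∸ j)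
      powers = trans (sym (^-homo-* A κ (N ∸ κ ∸ j))) (cong (A ^ℚ_) (m+[[n∸m]∸o]≡n∸o {κ} {j} {N} κ+j≤N))
      collect : ∀ c b p d e q → c * b * p * (d * e * q) ≡ (c * d) * b * e * (p * q)
      collect = Ring.solve-∀ ℚ-ring
      distribute : ∀ c d b e p → (c * d) * b * e * p ≡ c * e * p * (d * b)
      distribute = Ring.solve-∀ ℚ-ring

    rearrange : ∀ m b x → m * b * (x * 1ℚ) ≡ m * (x * b)
    rearrange = Ring.solve-∀ ℚ-ring

module FloorCeiling where

  open import Data.Nat using (suc; _+_; _*_; _∸_; _<_; _%_; _/_; NonZero)
  open import Data.Nat.Properties
  open import Data.Nat.DivMod
  import Data.Nat.Tactic.RingSolver as ℕ-Ring
  open import Relation.Binary.PropositionalEquality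
    using (_≡_; refl; sym; trans; cong; cong₂; subst; module ≡-Reasoning)

  open ≡-Reasoning

  floorDiv≡/ : ∀ n k .{{_ : NonZero k}} → floorDiv n k ≡ n / k
  floorDiv≡/ n (suc k) = refl

  ceilDiv-exact : ∀ n k .{{_ : NonZero k}} → n % k ≡ 0 → ceilDiv n k ≡ floorDiv n k
  ceilDiv-exact n (suc k) n%k≡0 = begin
    (n + suc k ∸ 1) / suc k        ≡⟨ cong (λ m → (m ∸ 1) / suc k) (+-suc n k) ⟩
    (n + k) / suc k                ≡⟨ cong (λ m → (m + k) / suc k) n≡qk ⟩
    (q * suc k + k) / suc k        ≡⟨ cong (_/ suc k) (+-comm (q * suc k) k) ⟩
    (k + q * suc k) / suc k        ≡⟨ +-distrib-/ k (q * suc k) remainders ⟩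
    k / suc k + q * suc k / suc k  ≡⟨ cong₂ _+_ (m<n⇒m/n≡0 (n<1+n k)) (m*n/n≡m q (suc k)) ⟩
    q                              ∎
    where
    q = n / suc k
    n≡qk : n ≡ q * suc k
    n≡qk = trans (m≡m%n+[m/n]*n n (suc k)) (cong (_+ q * suc k) n%k≡0)
    remainders : k % suc k + (q * suc k) % suc k < suc k
    remainders = subst (_< suc k) (sym (cong₂ _+_ (m<n⇒m%n≡m (n<1+n k)) (m*n%n≡0 q (suc k)))) (subst (_< suc k) (sym (+-identityʳ k)) (n<1+n k))

  ceilDiv-inexact : ∀ n k .{{_ : NonZero k}} r → n % k ≡ suc r → ceilDiv n k ≡ suc (floorDiv n k)
  ceilDiv-inexact n (suc k) r n%k≡1+r = begin
    (n + suc k ∸ 1) / suc k            ≡⟨ cong (λ m → (m ∸ 1) / suc k) (+-suc n k) ⟩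
    (n + k) / suc k                    ≡⟨ cong (λ m → (m + k) / suc k) n≡r+qk ⟩
    (suc r + q * suc k + k) / suc k    ≡⟨ cong (_/ suc k) (regroup r q k) ⟩
    (r + suc q * suc k) / suc k        ≡⟨ +-distrib-/ r (suc q * suc k) remainders ⟩
    r / suc k + suc q * suc k / suc k  ≡⟨ cong₂ _+_ (m<n⇒m/n≡0 r<k) (m*n/n≡m (suc q) (suc k)) ⟩
    suc q                              ∎
    where
    q = n / suc k
    n≡r+qk : n ≡ suc r + q * suc k
    n≡r+qk = trans (m≡m%n+[m/n]*n n (suc k)) (cong (_+ q * suc k) n%k≡1+r)
    r<k : r < suc k
    r<k = <-trans (n<1+n r) (subst (_< suc k) n%k≡1+r (m%n<n n (suc k)))
    remainders : r % suc k + (suc q * suc k) % suc k < suc k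
    remainders = subst (_< suc k) (sym (cong₂ _+_ (m<n⇒m%n≡m r<k) (m*n%n≡0 (suc q) (suc k)))) (subst (_< suc k) (sym (+-identityʳ r)) r<k)
    regroup : ∀ r q k → suc r + q * suc k + k ≡ r + suc q * suc k
    regroup = ℕ-Ring.solve-∀

-- b, c, s and s⁺ are parameters with their defining equations rather than
-- definitions, so that the instantiated statements are syntactically those of
-- the theorem; unfolding them during conversion checking is very slow.
module Semigroup (a h d b c s s⁺ : ℕ) {{_ : ℕ.NonZero a}} {{_ : ℕ.NonZero h}}
  (b≡ : b ≡ h ℕ.* a ∸ d) (c≡ : c ≡ h ℕ.* a ℕ.+ d) (s≡ : s ≡ floorDiv b (2 ℕ.* h)) (s⁺≡ : s⁺ ≡ ceilDiv b (2 ℕ.* h))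
  (0<d : 0 < d) (coprime : gcd a d ≡ 1) (1<b : 1 < b) where

  module AperySet where

    open FloorCeiling
    open import Data.Nat using (NonZero; zero; pred; _+_; _*_; _%_; _/_; _⊔_; z≤n; s≤s; _≤ᵇ_)
    open import Data.Integer as ℤ using (ℤ; +_)
    import Data.Integer.Properties as ℤ
    import Data.Integer.Tactic.RingSolver as ℤ-Ring
    open import Data.Nat.Properties
    open import Data.Nat.DivMod
    open import Data.Nat.GCD using (gcd-GCD; module Bézout; GCD)
    import Data.Nat.Tactic.RingSolver as ℕ-Ring
    open import Data.Bool using (true; false; T; if_then_else_)
    open import Data.Product using (∃; _×_; _,_; proj₁; proj₂)
    open import Data.Sum using (_⊎_; inj₁; inj₂)
    open import Data.Empty using (⊥-elim)
    open import Function using (_∘_)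
    open import Relation.Nullary using (¬_; yes; no)
    open import Relation.Binary.PropositionalEquality
      using (refl; sym; trans; cong; cong₂; subst; subst₂; module ≡-Reasoning)

    private instance
      2h≢0 : NonZero (2 * h)
      2h≢0 = m*n≢0 2 h

    0<a : 0 < a
    0<a = ℕ.>-nonZero⁻¹ a

    d<ha : d < h * a
    d<ha = m∸n≢0⇒n<m (λ ha∸d≡0 → <⇒≱ 1<b (≤-trans (≤-reflexive (trans b≡ ha∸d≡0)) z≤n))

    b+d≡ha : b + d ≡ h * a
    b+d≡ha = trans (cong (_+ d) b≡) (m∸n+n≡m (<⇒≤ d<ha))

    b+c≡2ha : b + c ≡ 2 * h * a
    b+c≡2ha = begin
      b + c            ≡⟨ cong (_+_ b) c≡ ⟩
      b + (h * a + d)  ≡⟨ move-d b (h * a) d ⟩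
      (b + d) + h * a  ≡⟨ cong (_+ h * a) b+d≡ha ⟩
      h * a + h * a    ≡⟨ double h a ⟩
      2 * h * a        ∎
      where
      open ≡-Reasoning
      move-d : ∀ b x d → b + (x + d) ≡ (b + d) + x
      move-d = ℕ-Ring.solve-∀
      double : ∀ h a → h * a + h * a ≡ 2 * h * a
      double = ℕ-Ring.solve-∀

    s≡b/2h : s ≡ b / (2 * h)
    s≡b/2h = trans s≡ (floorDiv≡/ b (2 * h))

    s*2h≤b : s * (2 * h) ≤ b
    s*2h≤b = subst (λ x → x * (2 * h) ≤ b) (sym s≡b/2h) (m/n*n≤m b (2 * h))

    b<[1+s]*2h : b < suc s * (2 * h)
    b<[1+s]*2h = begin-strict
      b                                    ≡⟨ m≡m%n+[m/n]*n b (2 * h) ⟩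
      b % (2 * h) + b / (2 * h) * (2 * h)  ≡⟨ cong (λ x → b % (2 * h) + x * (2 * h)) s≡b/2h ⟨
      b % (2 * h) + s * (2 * h)            <⟨ +-monoˡ-< (s * (2 * h)) (m%n<n b (2 * h)) ⟩
      suc s * (2 * h)                      ∎
      where open ≤-Reasoning

    s<a : s < a
    s<a = ≤-<-trans (m≤n+m s s) (subst (_< a) (cong (_+_ s) (+-identityʳ s)) 2s<a)
      where
      open ≤-Reasoning
      2s<a : 2 * s < a
      2s<a = *-cancelˡ-< h (2 * s) a (begin-strict
        h * (2 * s)  ≡⟨ commute h s ⟩
        s * (2 * h)  ≤⟨ s*2h≤b ⟩
        b            <⟨ m<m+n b 0<d ⟩
        b + d        ≡⟨ b+d≡ha ⟩
        h * a        ∎)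
        where
        commute : ∀ h s → h * (2 * s) ≡ s * (2 * h)
        commute = ℕ-Ring.solve-∀

    1+s+[a∸s∸1]≡a : suc s + (a ∸ s ∸ 1) ≡ a
    1+s+[a∸s∸1]≡a = trans (cong (_+_ (suc s)) (trans (∸-+-assoc a s 1) (cong (a ∸_) (+-comm s 1)))) (m+[n∸m]≡n s<a)

    %-*-absorbˡ : ∀ m n → (m % a * n) % a ≡ (m * n) % a
    %-*-absorbˡ m n = begin
      (m % a * n) % a            ≡⟨ %-distribˡ-* (m % a) n a ⟩
      (m % a % a * (n % a)) % a  ≡⟨ cong (λ z → (z * (n % a)) % a) (m%n%n≡m%n m a) ⟩
      (m % a * (n % a)) % a      ≡⟨ %-distribˡ-* m n a ⟨
      (m * n) % a                ∎
      where open ≡-Reasoning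

    %-*-absorbʳ : ∀ m n → (m * (n % a)) % a ≡ (m * n) % a
    %-*-absorbʳ m n = trans (cong (_% a) (*-comm m (n % a))) (trans (%-*-absorbˡ n m) (cong (_% a) (*-comm n m)))

    t*c%a≡t*d%a : ∀ t → (t * c) % a ≡ (t * d) % a
    t*c%a≡t*d%a t = trans (cong (λ z → (t * z) % a) c≡) (trans (cong (_% a) (expand t h a d)) ([m+kn]%n≡m%n (t * d) (t * h) a))
      where
      expand : ∀ t h a d → t * (h * a + d) ≡ t * d + t * h * a
      expand = ℕ-Ring.solve-∀

    [a∸t]*b%a≡t*d%a : ∀ t → t ≤ a → ((a ∸ t) * b) % a ≡ (t * d) % a
    [a∸t]*b%a≡t*d%a t t≤a = begin
      ((a ∸ t) * b) % a                      ≡⟨ [m+kn]%n≡m%n ((a ∸ t) * b) d a ⟨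
      ((a ∸ t) * b + d * a) % a              ≡⟨ cong (λ z → ((a ∸ t) * b + d * z) % a) (m+[n∸m]≡n t≤a) ⟨
      ((a ∸ t) * b + d * (t + (a ∸ t))) % a  ≡⟨ cong (_% a) (regroup (a ∸ t) b d t) ⟩
      (t * d + (a ∸ t) * (b + d)) % a        ≡⟨ cong (λ z → (t * d + (a ∸ t) * z) % a) b+d≡ha ⟩
      (t * d + (a ∸ t) * (h * a)) % a        ≡⟨ cong (λ z → (t * d + z) % a) (*-assoc (a ∸ t) h a) ⟨
      (t * d + (a ∸ t) * h * a) % a          ≡⟨ [m+kn]%n≡m%n (t * d) ((a ∸ t) * h) a ⟩
      (t * d) % a                            ∎
      where
      open ≡-Reasoning
      regroup : ∀ r b d t → r * b + d * (t + r) ≡ t * d + r * (b + d)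
      regroup = ℕ-Ring.solve-∀

    d-invertible : ∃ λ u → (d * u) % a ≡ 1 % a
    d-invertible with Bézout.identity (subst (GCD a d) coprime (gcd-GCD a d))
    ... | Bézout.+- x y 1+y*d≡x*a = y * pred a , (begin
      (d * (y * pred a)) % a                     ≡⟨ [m+kn]%n≡m%n (d * (y * pred a)) 1 a ⟨
      (d * (y * pred a) + 1 * a) % a             ≡⟨ cong (λ z → (d * (y * pred a) + 1 * z) % a) (suc-pred a) ⟨
      (d * (y * pred a) + 1 * suc (pred a)) % a  ≡⟨ cong (_% a) (regroup d y (pred a)) ⟩
      ((1 + y * d) * pred a + 1) % a             ≡⟨ cong (λ z → (z * pred a + 1) % a) 1+y*d≡x*a ⟩
      (x * a * pred a + 1) % a                   ≡⟨ cong (_% a) (regroup′ x a (pred a)) ⟩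
      (1 + x * pred a * a) % a                   ≡⟨ [m+kn]%n≡m%n 1 (x * pred a) a ⟩
      1 % a                                      ∎)
      where
      open ≡-Reasoning
      regroup : ∀ d y p → d * (y * p) + 1 * suc p ≡ (1 + y * d) * p + 1
      regroup = ℕ-Ring.solve-∀
      regroup′ : ∀ x a p → x * a * p + 1 ≡ 1 + x * p * a
      regroup′ = ℕ-Ring.solve-∀
    ... | Bézout.-+ x y 1+x*a≡y*d = y , (begin
      (d * y) % a      ≡⟨ cong (_% a) (*-comm d y) ⟩
      (y * d) % a      ≡⟨ cong (_% a) 1+x*a≡y*d ⟨
      (1 + x * a) % a  ≡⟨ [m+kn]%n≡m%n 1 x a ⟩
      1 % a            ∎)
      where open ≡-Reasoning

    τ : ℕ → ℕ
    τ ρ = (ρ * proj₁ d-invertible) % a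

    τ<a : ∀ ρ → τ ρ < a
    τ<a ρ = m%n<n (ρ * proj₁ d-invertible) a

    private
      cancel-d*u : ∀ t → t < a → (t * (d * proj₁ d-invertible)) % a ≡ t
      cancel-d*u t t<a = begin
        (t * (d * u)) % a        ≡⟨ %-*-absorbʳ t (d * u) ⟨
        (t * ((d * u) % a)) % a  ≡⟨ cong (λ z → (t * z) % a) (proj₂ d-invertible) ⟩
        (t * (1 % a)) % a        ≡⟨ %-*-absorbʳ t 1 ⟩
        (t * 1) % a              ≡⟨ cong (_% a) (*-identityʳ t) ⟩
        t % a                    ≡⟨ m<n⇒m%n≡m t<a ⟩
        t                        ∎
        where
        open ≡-Reasoning
        u = proj₁ d-invertible

    τ[ρ]*d%a≡ρ : ∀ ρ → ρ < a → (τ ρ * d) % a ≡ ρ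
    τ[ρ]*d%a≡ρ ρ ρ<a = begin
      (τ ρ * d) % a      ≡⟨ %-*-absorbˡ (ρ * u) d ⟩
      (ρ * u * d) % a    ≡⟨ cong (_% a) (regroup ρ u d) ⟩
      (ρ * (d * u)) % a  ≡⟨ cancel-d*u ρ ρ<a ⟩
      ρ                  ∎
      where
      open ≡-Reasoning
      u = proj₁ d-invertible
      regroup : ∀ ρ u d → ρ * u * d ≡ ρ * (d * u)
      regroup = ℕ-Ring.solve-∀

    τ[t*d%a]≡t : ∀ t → t < a → τ ((t * d) % a) ≡ t
    τ[t*d%a]≡t t t<a = begin
      ((t * d) % a * u) % a  ≡⟨ %-*-absorbˡ (t * d) u ⟩
      (t * d * u) % a        ≡⟨ cong (_% a) (*-assoc t d u) ⟩
      (t * (d * u)) % a      ≡⟨ cancel-d*u t t<a ⟩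
      t                      ∎
      where
      open ≡-Reasoning
      u = proj₁ d-invertible

    -- For t < a, apery t is the least element of ⟨a, b, c⟩ congruent to t·d modulo a,
    -- so apery ∘ τ enumerates the Apéry set of ⟨a, b, c⟩ with respect to a.
    apery : ℕ → ℕ
    apery t = if t ≤ᵇ s then t * c else (a ∸ t) * b

    apery≡t*c : ∀ {t} → t ≤ s → apery t ≡ t * c
    apery≡t*c {t} t≤s with t ≤ᵇ s | ≤⇒≤ᵇ t≤s
    ... | true | _ = refl

    apery≡[a∸t]*b : ∀ {t} → s < t → apery t ≡ (a ∸ t) * b
    apery≡[a∸t]*b {t} s<t with t ≤ᵇ s in t≤ᵇs
    ... | false = refl
    ... | true  = ⊥-elim (<⇒≱ s<t (≤ᵇ⇒≤ t s (subst T (sym t≤ᵇs) _)))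

    apery%a≡t*d%a : ∀ t → t ≤ a → apery t % a ≡ (t * d) % a
    apery%a≡t*d%a t t≤a with t ≤? s
    ... | yes t≤s = trans (cong (_% a) (apery≡t*c t≤s)) (t*c%a≡t*d%a t)
    ... | no  t≰s = trans (cong (_% a) (apery≡[a∸t]*b (≰⇒> t≰s))) ([a∸t]*b%a≡t*d%a t t≤a)

    t*c≤[a∸t]*b : ∀ {t} → t ≤ s → t * c ≤ (a ∸ t) * b
    t*c≤[a∸t]*b {t} t≤s = subst (t * c ≤_) (sym (*-distribʳ-∸ b a t)) (m+n≤o⇒m≤o∸n (t * c) (begin
      t * c + t * b    ≡⟨ *-distribˡ-+ t c b ⟨
      t * (c + b)      ≡⟨ cong (t *_) (trans (+-comm c b) b+c≡2ha) ⟩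
      t * (2 * h * a)  ≡⟨ regroup t h a ⟩
      t * (2 * h) * a  ≤⟨ *-monoˡ-≤ a (*-monoˡ-≤ (2 * h) t≤s) ⟩
      s * (2 * h) * a  ≤⟨ *-monoˡ-≤ a s*2h≤b ⟩
      b * a            ≡⟨ *-comm b a ⟩
      a * b            ∎))
      where
      open ≤-Reasoning
      regroup : ∀ t h a → t * (2 * h * a) ≡ t * (2 * h) * a
      regroup = ℕ-Ring.solve-∀

    [a∸t]*b<t*c : ∀ {t} → s < t → t ≤ a → (a ∸ t) * b < t * c
    [a∸t]*b<t*c {t} s<t t≤a = +-cancelʳ-< (t * b) ((a ∸ t) * b) (t * c) (begin-strict
      (a ∸ t) * b + t * b  ≡⟨ *-distribʳ-+ b (a ∸ t) t ⟨
      (a ∸ t + t) * b      ≡⟨ cong (_* b) (m∸n+n≡m t≤a) ⟩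
      a * b                ≡⟨ *-comm a b ⟩
      b * a                <⟨ *-monoˡ-< a b<[1+s]*2h ⟩
      suc s * (2 * h) * a  ≤⟨ *-monoˡ-≤ a (*-monoˡ-≤ (2 * h) s<t) ⟩
      t * (2 * h) * a      ≡⟨ regroup t h a ⟩
      t * (2 * h * a)      ≡⟨ cong (t *_) (trans (+-comm c b) b+c≡2ha) ⟨
      t * (c + b)          ≡⟨ *-distribˡ-+ t c b ⟩
      t * c + t * b        ∎)
      where
      open ≤-Reasoning
      regroup : ∀ t h a → t * (2 * h) * a ≡ t * (2 * h * a)
      regroup = ℕ-Ring.solve-∀

    apery≤t*c : ∀ t → t ≤ a → apery t ≤ t * c
    apery≤t*c t t≤a with t ≤? s
    ... | yes t≤s = ≤-reflexive (apery≡t*c t≤s)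
    ... | no  t≰s = subst (_≤ t * c) (sym (apery≡[a∸t]*b (≰⇒> t≰s))) (<⇒≤ ([a∸t]*b<t*c (≰⇒> t≰s) t≤a))

    apery≤[a∸t]*b : ∀ t → apery t ≤ (a ∸ t) * b
    apery≤[a∸t]*b t with t ≤? s
    ... | yes t≤s = subst (_≤ (a ∸ t) * b) (sym (apery≡t*c t≤s)) (t*c≤[a∸t]*b t≤s)
    ... | no  t≰s = ≤-reflexive (apery≡[a∸t]*b (≰⇒> t≰s))

    Rep : ℕ → Set
    Rep = Representable a b c

    apery+ka-representable : ∀ t k → Rep (apery t + k * a)
    apery+ka-representable t k with t ≤? s
    ... | yes t≤s = k , 0 , t , trans (regroup a b c k t) (cong (_+ k * a) (sym (apery≡t*c t≤s)))
      where
      regroup : ∀ a b c k t → a * k + b * 0 + c * t ≡ t * c + k * a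
      regroup = ℕ-Ring.solve-∀
    ... | no  t≰s = k , a ∸ t , 0 , trans (regroup a b c k (a ∸ t)) (cong (_+ k * a) (sym (apery≡[a∸t]*b (≰⇒> t≰s))))
      where
      regroup : ∀ a b c k r → a * k + b * r + c * 0 ≡ r * b + k * a
      regroup = ℕ-Ring.solve-∀

    ≡-mod-a⇒+multiple : ∀ {x y} → x ≤ y → x % a ≡ y % a → ∃ λ k → y ≡ x + k * a
    ≡-mod-a⇒+multiple {x} {y} x≤y x≡y = y / a ∸ x / a , (begin
      y                                          ≡⟨ m≡m%n+[m/n]*n y a ⟩
      y % a + y / a * a                          ≡⟨ cong₂ (λ r q → r + q * a) (sym x≡y) (sym (m+[n∸m]≡n (/-monoˡ-≤ a x≤y))) ⟩
      x % a + (x / a + (y / a ∸ x / a)) * a      ≡⟨ regroup (x % a) (x / a) (y / a ∸ x / a) a ⟩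
      (x % a + x / a * a) + (y / a ∸ x / a) * a  ≡⟨ cong (_+ (y / a ∸ x / a) * a) (m≡m%n+[m/n]*n x a) ⟨
      x + (y / a ∸ x / a) * a                    ∎)
      where
      open ≡-Reasoning
      regroup : ∀ r q k a → r + (q + k) * a ≡ (r + q * a) + k * a
      regroup = ℕ-Ring.solve-∀

    ≡-mod-a-gap : ∀ {x y} → x < y → x % a ≡ y % a → x + a ≤ y
    ≡-mod-a-gap {x} {y} x<y x≡y with ≡-mod-a⇒+multiple (<⇒≤ x<y) x≡y
    ... | zero  , y≡x+0 = ⊥-elim (<⇒≢ x<y (sym (trans y≡x+0 (+-identityʳ x))))
    ... | suc k , y≡x+[1+k]a = subst (x + a ≤_) (sym y≡x+[1+k]a) (+-monoʳ-≤ x (m≤m+n a (k * a)))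

    apery∘τ-residue : ∀ m → apery (τ (m % a)) % a ≡ m % a
    apery∘τ-residue m = trans (apery%a≡t*d%a (τ (m % a)) (<⇒≤ (τ<a (m % a)))) (τ[ρ]*d%a≡ρ (m % a) (m%n<n m a))

    apery≤⇒representable : ∀ m → apery (τ (m % a)) ≤ m → Rep m
    apery≤⇒representable m apery≤m =
      subst Rep (sym (proj₂ m-apery)) (apery+ka-representable (τ (m % a)) (proj₁ m-apery))
      where
      m-apery : ∃ λ k → m ≡ apery (τ (m % a)) + k * a
      m-apery = ≡-mod-a⇒+multiple apery≤m (apery∘τ-residue m)

    bound-and-residue : ∀ r k {m} → r + k * a ≡ m → r ≤ m × r % a ≡ m % a
    bound-and-residue r k refl = m≤m+n r (k * a) , sym ([m+kn]%n≡m%n r k a)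

    pair-off : ∀ {u v} → u + v ≡ 2 * h * a → ∀ x y e → a * x + u * y + v * (y + e) ≡ e * v + (x + 2 * h * y) * a
    pair-off {u} {v} u+v≡2ha x y e = begin
      a * x + u * y + v * (y + e)    ≡⟨ collect a u v x y e ⟩
      e * v + a * x + (u + v) * y    ≡⟨ cong (λ w → e * v + a * x + w * y) u+v≡2ha ⟩
      e * v + a * x + 2 * h * a * y  ≡⟨ factor v e a x h y ⟩
      e * v + (x + 2 * h * y) * a    ∎
      where
      open ≡-Reasoning
      collect : ∀ a u v x y e → a * x + u * y + v * (y + e) ≡ e * v + a * x + (u + v) * y
      collect = ℕ-Ring.solve-∀
      factor : ∀ v e a x h y → e * v + a * x + 2 * h * a * y ≡ e * v + (x + 2 * h * y) * a
      factor = ℕ-Ring.solve-∀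

    representable⇒multiple : ∀ {m} → Rep m →
      ∃ λ e → (e * c ≤ m × (e * c) % a ≡ m % a) ⊎ (e * b ≤ m × (e * b) % a ≡ m % a)
    representable⇒multiple {m} (x , y , z , ax+by+cz≡m) with ≤-total y z
    ... | inj₁ y≤z = z ∸ y , inj₁ (bound-and-residue ((z ∸ y) * c) (x + 2 * h * y) (begin
      (z ∸ y) * c + (x + 2 * h * y) * a  ≡⟨ pair-off b+c≡2ha x y (z ∸ y) ⟨
      a * x + b * y + c * (y + (z ∸ y))  ≡⟨ cong (λ w → a * x + b * y + c * w) (m+[n∸m]≡n y≤z) ⟩
      a * x + b * y + c * z              ≡⟨ ax+by+cz≡m ⟩
      m                                  ∎))
      where open ≡-Reasoning
    ... | inj₂ z≤y = y ∸ z , inj₂ (bound-and-residue ((y ∸ z) * b) (x + 2 * h * z) (begin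
      (y ∸ z) * b + (x + 2 * h * z) * a  ≡⟨ pair-off (trans (+-comm c b) b+c≡2ha) x z (y ∸ z) ⟨
      a * x + c * z + b * (z + (y ∸ z))  ≡⟨ cong (λ w → a * x + c * z + b * w) (m+[n∸m]≡n z≤y) ⟩
      a * x + c * z + b * y              ≡⟨ +-assoc (a * x) (c * z) (b * y) ⟩
      a * x + (c * z + b * y)            ≡⟨ cong (_+_ (a * x)) (+-comm (c * z) (b * y)) ⟩
      a * x + (b * y + c * z)            ≡⟨ +-assoc (a * x) (b * y) (c * z) ⟨
      a * x + b * y + c * z              ≡⟨ ax+by+cz≡m ⟩
      m                                  ∎))
      where open ≡-Reasoning

    apery-bound : ∀ m t → t < a → (t * d) % a ≡ m % a → apery t ≤ m → apery (τ (m % a)) ≤ m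
    apery-bound m t t<a t*d≡m apery≤m = subst (_≤ m) (cong apery (sym (trans (cong τ (sym t*d≡m)) (τ[t*d%a]≡t t t<a)))) apery≤m

    representable⇒apery≤ : ∀ m → Rep m → apery (τ (m % a)) ≤ m
    representable⇒apery≤ m rep with representable⇒multiple rep
    ... | e , inj₁ (e*c≤m , e*c≡m) = apery-bound m (e % a) (m%n<n e a) residue (begin
      apery (e % a)  ≤⟨ apery≤t*c (e % a) (m%n≤n e a) ⟩
      e % a * c      ≤⟨ *-monoˡ-≤ c (m%n≤m e a) ⟩
      e * c          ≤⟨ e*c≤m ⟩
      m              ∎)
      where
      open ≤-Reasoning
      residue : (e % a * d) % a ≡ m % a
      residue = trans (%-*-absorbˡ e d) (trans (sym (t*c%a≡t*d%a e)) e*c≡m)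
    ... | e , inj₂ (e*b≤m , e*b≡m) = by-residue (e % a) refl
      where
      e%a*b≡m : (e % a * b) % a ≡ m % a
      e%a*b≡m = trans (%-*-absorbˡ e b) e*b≡m
      by-residue : ∀ r → e % a ≡ r → apery (τ (m % a)) ≤ m
      by-residue zero    e%a≡0 = apery-bound m 0 0<a (trans (sym (cong (λ r → (r * b) % a) e%a≡0)) e%a*b≡m) (≤-trans (apery≤t*c 0 z≤n) z≤n)
      by-residue (suc _) e%a≡1+r = apery-bound m t t<a residue (begin
        apery t      ≤⟨ apery≤[a∸t]*b t ⟩
        (a ∸ t) * b  ≡⟨ cong (_* b) a∸t≡e%a ⟩
        e % a * b    ≤⟨ *-monoˡ-≤ b (m%n≤m e a) ⟩
        e * b        ≤⟨ e*b≤m ⟩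
        m            ∎)
        where
        open ≤-Reasoning
        t = a ∸ e % a
        a∸t≡e%a : a ∸ t ≡ e % a
        a∸t≡e%a = m∸[m∸n]≡n (m%n≤n e a)
        t<a : t < a
        t<a = ∸-monoʳ-< (subst (0 <_) (sym e%a≡1+r) (s≤s z≤n)) (m%n≤n e a)
        residue : (t * d) % a ≡ m % a
        residue = trans (sym ([a∸t]*b%a≡t*d%a t (m∸n≤m a (e % a)))) (trans (cong (λ r → (r * b) % a) a∸t≡e%a) e%a*b≡m)

    s⁺-cases : (s⁺ ≡ s × (a ∸ s) * b ≡ s * c) ⊎ s⁺ ≡ suc s
    s⁺-cases with b % (2 * h) in b%2h
    ... | zero  = inj₁ (trans s⁺≡ (trans (ceilDiv-exact b (2 * h) b%2h) (sym s≡)) , balanced)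
      where
      open ≡-Reasoning
      b≡s*2h : b ≡ s * (2 * h)
      b≡s*2h = trans (m≡m%n+[m/n]*n b (2 * h)) (cong₂ (λ r q → r + q * (2 * h)) b%2h (sym s≡b/2h))
      balanced : (a ∸ s) * b ≡ s * c
      balanced = +-cancelʳ-≡ (s * b) ((a ∸ s) * b) (s * c) (begin
        (a ∸ s) * b + s * b  ≡⟨ *-distribʳ-+ b (a ∸ s) s ⟨
        (a ∸ s + s) * b      ≡⟨ cong (_* b) (m∸n+n≡m (<⇒≤ s<a)) ⟩
        a * b                ≡⟨ cong (a *_) b≡s*2h ⟩
        a * (s * (2 * h))    ≡⟨ regroup a s h ⟩
        s * (2 * h * a)      ≡⟨ cong (s *_) b+c≡2ha ⟨
        s * (b + c)          ≡⟨ trans (*-distribˡ-+ s b c) (+-comm (s * b) (s * c)) ⟩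
        s * c + s * b        ∎)
        where
        regroup : ∀ a s h → a * (s * (2 * h)) ≡ s * (2 * h * a)
        regroup = ℕ-Ring.solve-∀
    ... | suc r = inj₂ (trans s⁺≡ (trans (ceilDiv-inexact b (2 * h) r b%2h) (cong suc (sym s≡))))

    s⁺≤1+s : s⁺ ≤ suc s
    s⁺≤1+s with s⁺-cases
    ... | inj₁ (s⁺≡s , _) = subst (_≤ suc s) (sym s⁺≡s) (n≤1+n s)
    ... | inj₂ s⁺≡1+s     = ≤-reflexive s⁺≡1+s

    maxApery : ℕ
    maxApery = s * c ⊔ (a ∸ s⁺) * b

    apery≤maxApery : ∀ t → apery t ≤ maxApery
    apery≤maxApery t with t ≤? s
    ... | yes t≤s = begin
      apery t   ≡⟨ apery≡t*c t≤s ⟩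
      t * c     ≤⟨ *-monoˡ-≤ c t≤s ⟩
      s * c     ≤⟨ m≤m⊔n (s * c) _ ⟩
      maxApery  ∎
      where open ≤-Reasoning
    ... | no t≰s = begin
      apery t       ≡⟨ apery≡[a∸t]*b (≰⇒> t≰s) ⟩
      (a ∸ t) * b   ≤⟨ *-monoˡ-≤ b (∸-monoʳ-≤ a (≤-trans s⁺≤1+s (≰⇒> t≰s))) ⟩
      (a ∸ s⁺) * b  ≤⟨ m≤n⊔m (s * c) _ ⟩
      maxApery      ∎
      where open ≤-Reasoning

    maxApery-attained : ∃ λ t → t < a × apery t ≡ maxApery
    maxApery-attained with (a ∸ s⁺) * b ≤? s * c
    ... | yes ≤s*c = s , s<a , trans (apery≡t*c ≤-refl) (sym (m≥n⇒m⊔n≡m ≤s*c))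
    ... | no  ≰s*c with s⁺-cases
    ...   | inj₁ (s⁺≡s , balanced) = ⊥-elim (≰s*c (≤-reflexive (trans (cong (λ t → (a ∸ t) * b) s⁺≡s) balanced)))
    ...   | inj₂ s⁺≡1+s = suc s , 1+s<a , (begin
      apery (suc s)      ≡⟨ apery≡[a∸t]*b ≤-refl ⟩
      (a ∸ suc s) * b    ≡⟨ cong (λ t → (a ∸ t) * b) s⁺≡1+s ⟨
      (a ∸ s⁺) * b       ≡⟨ m≤n⇒m⊔n≡n (<⇒≤ (≰⇒> ≰s*c)) ⟨
      maxApery           ∎)
      where
      open ≡-Reasoning
      1+s<a : suc s < a
      1+s<a = m∸n≢0⇒n<m λ a∸[1+s]≡0 →
        ≰s*c (≤-trans (≤-reflexive (trans (cong (λ t → (a ∸ t) * b) s⁺≡1+s) (cong (_* b) a∸[1+s]≡0))) z≤n)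

    frobenius-formula : (+ (s * c) ℤ.- + a) ℤ.⊔ ((+ a ℤ.- + s⁺) ℤ.* + b ℤ.- + a) ≡ + maxApery ℤ.- + a
    frobenius-formula = begin
      (+ (s * c) ℤ.- + a) ℤ.⊔ ((+ a ℤ.- + s⁺) ℤ.* + b ℤ.- + a)
        ≡⟨ ℤ.mono-≤-distrib-⊔ (ℤ.+-monoˡ-≤ (ℤ.- + a)) (+ (s * c)) ((+ a ℤ.- + s⁺) ℤ.* + b) ⟨
      (+ (s * c) ℤ.⊔ ((+ a ℤ.- + s⁺) ℤ.* + b)) ℤ.- + a
        ≡⟨ cong (λ z → (+ (s * c) ℤ.⊔ z) ℤ.- + a) a-s⁺ ⟩
      + maxApery ℤ.- + a                                          ∎
      where
      open ≡-Reasoning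
      a-s⁺ : (+ a ℤ.- + s⁺) ℤ.* + b ≡ + ((a ∸ s⁺) * b)
      a-s⁺ = begin
        (+ a ℤ.- + s⁺) ℤ.* + b  ≡⟨ cong (ℤ._* + b) (trans (ℤ.m-n≡m⊖n a s⁺) (ℤ.⊖-≥ (≤-trans s⁺≤1+s s<a))) ⟩
        + (a ∸ s⁺) ℤ.* + b      ≡⟨ ℤ.pos-* (a ∸ s⁺) b ⟨
        + ((a ∸ s⁺) * b)        ∎

    above-frobenius-representable : ∀ m → + maxApery ℤ.- + a ℤ.< + m → Rep m
    above-frobenius-representable m g<m = apery≤⇒representable m (≮⇒≥ m≮apery)
      where
      maxApery<m+a : maxApery < m + a
      maxApery<m+a = ℤ.drop‿+<+ (subst₂ ℤ._<_ (cancel (+ maxApery) (+ a)) (sym (ℤ.pos-+ m a)) (ℤ.+-monoˡ-< (+ a) g<m))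
        where
        cancel : ∀ g a → g ℤ.- a ℤ.+ a ≡ g
        cancel = ℤ-Ring.solve-∀
      m≮apery : ¬ m < apery (τ (m % a))
      m≮apery m<apery = <⇒≱ (≤-<-trans (apery≤maxApery (τ (m % a))) maxApery<m+a)
                             (≡-mod-a-gap m<apery (sym (apery∘τ-residue m)))

    frobenius-not-representable : ∀ m → + m ≡ + maxApery ℤ.- + a → ¬ Rep m
    frobenius-not-representable m m≡g rep = <⇒≱ (m<m+n m 0<a) (begin
      m + a              ≡⟨ m+a≡maxApery ⟩
      maxApery           ≡⟨ apery-t* ⟨
      apery t*           ≡⟨ cong apery τ[m%a]≡t* ⟨
      apery (τ (m % a))  ≤⟨ representable⇒apery≤ m rep ⟩
      m                  ∎)
      where
      open ≤-Reasoning
      t* = proj₁ maxApery-attained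
      t*<a = proj₁ (proj₂ maxApery-attained)
      apery-t* = proj₂ (proj₂ maxApery-attained)
      m+a≡maxApery : m + a ≡ maxApery
      m+a≡maxApery = ℤ.+-injective (trans (ℤ.pos-+ m a) (trans (cong (ℤ._+ + a) m≡g) (cancel (+ maxApery) (+ a))))
        where
        cancel : ∀ g a → g ℤ.- a ℤ.+ a ≡ g
        cancel = ℤ-Ring.solve-∀
      τ[m%a]≡t* : τ (m % a) ≡ t*
      τ[m%a]≡t* = begin-equality
        τ (m % a)         ≡⟨ cong τ ([m+n]%n≡m%n m a) ⟨
        τ ((m + a) % a)   ≡⟨ cong (λ x → τ (x % a)) (trans m+a≡maxApery (sym apery-t*)) ⟩
        τ (apery t* % a)  ≡⟨ cong τ (apery%a≡t*d%a t* (<⇒≤ t*<a)) ⟩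
        τ ((t* * d) % a)  ≡⟨ τ[t*d%a]≡t t* t*<a ⟩
        t*                ∎

    gaps : ℕ → ℕ
    gaps ρ = apery (τ ρ) / a

    apery∘τ≡ρ+gaps*a : ∀ ρ → ρ < a → apery (τ ρ) ≡ ρ + gaps ρ * a
    apery∘τ≡ρ+gaps*a ρ ρ<a = trans (m≡m%n+[m/n]*n (apery (τ ρ)) a) (cong (_+ gaps ρ * a) residue)
      where
      residue : apery (τ ρ) % a ≡ ρ
      residue = trans (apery%a≡t*d%a (τ ρ) (<⇒≤ (τ<a ρ))) (τ[ρ]*d%a≡ρ ρ ρ<a)

    private
      [ρ+ka]%a≡ρ : ∀ ρ k → ρ < a → (ρ + k * a) % a ≡ ρ
      [ρ+ka]%a≡ρ ρ k ρ<a = trans ([m+kn]%n≡m%n ρ k a) (m<n⇒m%n≡m ρ<a)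

    representable⇒gaps≤ : ∀ ρ k → ρ < a → Rep (ρ + k * a) → gaps ρ ≤ k
    representable⇒gaps≤ ρ k ρ<a rep = *-cancelʳ-≤ (gaps ρ) k a (+-cancelˡ-≤ ρ (gaps ρ * a) (k * a) (begin
      ρ + gaps ρ * a               ≡⟨ apery∘τ≡ρ+gaps*a ρ ρ<a ⟨
      apery (τ ρ)                  ≡⟨ cong (apery ∘ τ) ([ρ+ka]%a≡ρ ρ k ρ<a) ⟨
      apery (τ ((ρ + k * a) % a))  ≤⟨ representable⇒apery≤ (ρ + k * a) rep ⟩
      ρ + k * a                    ∎))
      where open ≤-Reasoning

    gaps≤⇒representable : ∀ ρ k → ρ < a → gaps ρ ≤ k → Rep (ρ + k * a)
    gaps≤⇒representable ρ k ρ<a gaps≤k = apery≤⇒representable (ρ + k * a) (begin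
      apery (τ ((ρ + k * a) % a))  ≡⟨ cong (apery ∘ τ) ([ρ+ka]%a≡ρ ρ k ρ<a) ⟩
      apery (τ ρ)                  ≡⟨ apery∘τ≡ρ+gaps*a ρ ρ<a ⟩
      ρ + gaps ρ * a               ≤⟨ +-monoʳ-≤ ρ (*-monoˡ-≤ a gaps≤k) ⟩
      ρ + k * a                    ∎)
      where open ≤-Reasoning

  module PowerSums where

    open Cast
    open FiniteSums
    open Bernoulli
    open AperySet
    open import Data.Nat using (s≤s; _%_; _^_)
    import Data.Nat.Properties as ℕ
    open import Data.Nat.DivMod using (m%n<n)
    open import Data.Nat.Combinatorics using (_C_)
    open import Data.List using (map; upTo)
    open import Data.Rational using (ℚ; 0ℚ; 1ℚ; _+_; _*_; _-_; -_)
    open import Data.Rational.Properties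
    open import Function using (_∘_)
    open import Relation.Nullary using (¬_; ¬?)
    open import Relation.Binary.PropositionalEquality
      using (sym; trans; cong; cong₂; module ≡-Reasoning)
    import Tactic.RingSolver as Ring

    open ≡-Reasoning

    gap? : ℕ → ℚ
    gap? m = 𝟙 (¬? (representable? a b c m))

    gap?≡0 : ∀ {m} → Rep m → gap? m ≡ 0ℚ
    gap?≡0 {m} rep = 𝟙-fails (¬? (representable? a b c m)) (λ ¬rep → ¬rep rep)

    gap?≡1 : ∀ {m} → ¬ Rep m → gap? m ≡ 1ℚ
    gap?≡1 {m} = 𝟙-holds (¬? (representable? a b c m))

    aperyPowerSum : ℕ → ℚ
    aperyPowerSum p = ∑[ t < a ] (ι (apery t) ^ℚ p)

    gapPowerSum : ℕ → ℕ → ℕ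
    gapPowerSum N μ = sumℕ (map (λ m → m ^ μ) (NRbelow a b c N))

    module _ (N : ℕ) (representable-from-N : ∀ m → N ≤ m → Rep m) where

      gaps≤N : ∀ ρ → ρ < a → gaps ρ ≤ N
      gaps≤N ρ ρ<a = ℕ.≮⇒≥ λ N<gaps → ℕ.<⇒≱ N<gaps (representable⇒gaps≤ ρ N ρ<a (representable-from-N (ρ ℕ.+ N ℕ.* a) N≤ρ+Na))
        where
        N≤ρ+Na : N ≤ ρ ℕ.+ N ℕ.* a
        N≤ρ+Na = ℕ.≤-trans (ℕ.m≤m*n N a) (ℕ.m≤n+m (N ℕ.* a) ρ)

      ∑-residue-class : ∀ μ ρ → ρ < a →
        ∑[ k < N ] (gap? (ρ ℕ.+ k ℕ.* a) * ι (ρ ℕ.+ k ℕ.* a) ^ℚ μ) ≡ ∑[ k < gaps ρ ] (ι (ρ ℕ.+ k ℕ.* a) ^ℚ μ)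
      ∑-residue-class μ ρ ρ<a = begin
        ∑[ k < N ] G k
          ≡⟨ cong (λ n → ∑< n G) (ℕ.m+[n∸m]≡n (gaps≤N ρ ρ<a)) ⟨
        ∑[ k < gaps ρ ℕ.+ (N ∸ gaps ρ) ] G k
          ≡⟨ ∑-zero-tail (gaps ρ) (N ∸ gaps ρ) G (λ k gaps≤k → trans (cong (_* _) (gap?≡0 (gaps≤⇒representable ρ k ρ<a gaps≤k))) (*-zeroˡ (ι (ρ ℕ.+ k ℕ.* a) ^ℚ μ))) ⟩
        ∑[ k < gaps ρ ] G k
          ≡⟨ ∑-cong (gaps ρ) (λ k k<gaps → trans (cong (_* _) (gap?≡1 (λ rep → ℕ.<⇒≱ k<gaps (representable⇒gaps≤ ρ k ρ<a rep)))) (*-identityˡ _)) ⟩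
        ∑[ k < gaps ρ ] (ι (ρ ℕ.+ k ℕ.* a) ^ℚ μ)  ∎
        where
        G : ℕ → ℚ
        G k = gap? (ρ ℕ.+ k ℕ.* a) * ι (ρ ℕ.+ k ℕ.* a) ^ℚ μ

      ι-gapPowerSum : ∀ μ → ι (gapPowerSum N μ) ≡ ∑[ ρ < a ] ∑[ k < gaps ρ ] (ι (ρ ℕ.+ k ℕ.* a) ^ℚ μ)
      ι-gapPowerSum μ = begin
        ι (gapPowerSum N μ)
          ≡⟨ ι-sumℕ-filter (λ m → ¬? (representable? a b c m)) (λ m → m ^ μ) (upTo N) ⟩
        sumℚ (map (λ m → gap? m * ι (m ^ μ)) (upTo N))
          ≡⟨ sumℚ-map-upTo N _ ⟩
        ∑[ m < N ] (gap? m * ι (m ^ μ))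
          ≡⟨ ∑-cong N (λ m _ → cong (gap? m *_) (ι-^ m μ)) ⟩
        ∑< N G
          ≡⟨ ∑-zero-tail N (N ℕ.* a ∸ N) G (λ m N≤m → trans (cong (_* _) (gap?≡0 (representable-from-N m N≤m))) (*-zeroˡ (ι m ^ℚ μ))) ⟨
        ∑< (N ℕ.+ (N ℕ.* a ∸ N)) G
          ≡⟨ cong (λ n → ∑< n G) (ℕ.m+[n∸m]≡n (ℕ.m≤m*n N a)) ⟩
        ∑< (N ℕ.* a) G
          ≡⟨ ∑-blocks N a G ⟩
        ∑[ k < N ] ∑[ ρ < a ] G (ρ ℕ.+ k ℕ.* a)
          ≡⟨ ∑-comm N a _ ⟩
        ∑[ ρ < a ] ∑[ k < N ] G (ρ ℕ.+ k ℕ.* a)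
          ≡⟨ ∑-cong a (λ ρ ρ<a → ∑-residue-class μ ρ ρ<a) ⟩
        ∑[ ρ < a ] ∑[ k < gaps ρ ] (ι (ρ ℕ.+ k ℕ.* a) ^ℚ μ)  ∎
        where
        G : ℕ → ℚ
        G m = gap? m * ι m ^ℚ μ

      gapPowerSum-bernoulli : ∀ μ →
        ι (suc μ) * (ι a * ι (gapPowerSum N μ))
          ≡ ∑[ t < a ] bernoulliPoly (suc μ) (ι a) (ι (apery t)) - ι a * B (suc μ)
      gapPowerSum-bernoulli μ = begin
        ι (suc μ) * (ι a * ι (gapPowerSum N μ))
          ≡⟨ cong (λ x → ι (suc μ) * (ι a * x)) (ι-gapPowerSum μ) ⟩
        ι (suc μ) * (ι a * ∑[ ρ < a ] F ρ)
          ≡⟨ cong (ι (suc μ) *_) (*-distribˡ-∑ a (ι a) F) ⟩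
        ι (suc μ) * ∑[ ρ < a ] (ι a * F ρ)
          ≡⟨ *-distribˡ-∑ a (ι (suc μ)) _ ⟩
        ∑[ ρ < a ] (ι (suc μ) * (ι a * F ρ))
          ≡⟨ ∑-cong a (λ ρ ρ<a → residue-class ρ ρ<a) ⟩
        ∑[ ρ < a ] (P (ι (apery (τ ρ))) - P (ι ρ))
          ≡⟨ ∑-distrib-+ a _ _ ⟩
        ∑[ ρ < a ] P (ι (apery (τ ρ))) + ∑[ ρ < a ] (- P (ι ρ))
          ≡⟨ cong₂ _+_ (∑-reindex a τ (λ t → (t ℕ.* d) % a) (λ ρ _ → τ<a ρ) (λ t _ → m%n<n (t ℕ.* d) a)
                                    τ[ρ]*d%a≡ρ τ[t*d%a]≡t (P ∘ ι ∘ apery))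
                       (sym (neg-distrib-∑ a (P ∘ ι))) ⟩
        ∑[ t < a ] P (ι (apery t)) - ∑[ ρ < a ] P (ι ρ)
          ≡⟨ cong (λ x → ∑[ t < a ] P (ι (apery t)) - x) (bernoulliPoly-raabe (suc μ) a) ⟩
        ∑[ t < a ] P (ι (apery t)) - ι a * B (suc μ)  ∎
        where
        P = bernoulliPoly (suc μ) (ι a)
        F : ℕ → ℚ
        F ρ = ∑[ k < gaps ρ ] (ι (ρ ℕ.+ k ℕ.* a) ^ℚ μ)
        residue-class : ∀ ρ → ρ < a → ι (suc μ) * (ι a * F ρ) ≡ P (ι (apery (τ ρ))) - P (ι ρ)
        residue-class ρ ρ<a = begin
          ι (suc μ) * (ι a * F ρ)
            ≡⟨ cong (λ x → ι (suc μ) * (ι a * x)) (∑-cong (gaps ρ) (λ k _ → cong (_^ℚ μ) (ι-progression k))) ⟩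
          ι (suc μ) * (ι a * ∑[ k < gaps ρ ] ((ι ρ + ι k * ι a) ^ℚ μ))
            ≡⟨ bernoulliPoly-∑-progression μ (ι a) (ι ρ) (gaps ρ) ⟩
          P (ι ρ + ι (gaps ρ) * ι a) - P (ι ρ)
            ≡⟨ cong (λ x → P x - P (ι ρ)) (sym (trans (cong ι (apery∘τ≡ρ+gaps*a ρ ρ<a)) (ι-progression (gaps ρ)))) ⟩
          P (ι (apery (τ ρ))) - P (ι ρ)  ∎
          where
          ι-progression : ∀ k → ι (ρ ℕ.+ k ℕ.* a) ≡ ι ρ + ι k * ι a
          ι-progression k = trans (ι-+ ρ (k ℕ.* a)) (cong (_+_ (ι ρ)) (ι-* k a))

      gapPowerSum-formula : ∀ μ →
        ι (suc μ) * (ι a * ι (gapPowerSum N μ))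
          ≡ ∑[ κ < suc μ ] (ι (suc μ C κ) * B κ * ι a ^ℚ κ * aperyPowerSum (suc μ ∸ κ))
            + ι a * B (suc μ) * (ι a ^ℚ suc μ - 1ℚ)
      gapPowerSum-formula μ = begin
        ι (suc μ) * (ι a * ι (gapPowerSum N μ))
          ≡⟨ gapPowerSum-bernoulli μ ⟩
        ∑[ t < a ] bernoulliPoly (suc μ) (ι a) (ι (apery t)) - ι a * B (suc μ)
          ≡⟨ cong (_- ι a * B (suc μ)) (∑-bernoulliPoly-top (suc μ) a (ι a) (ι ∘ apery)) ⟩
        (S + ι a * (B (suc μ) * ι a ^ℚ suc μ)) - ι a * B (suc μ)
          ≡⟨ factor S (ι a) (B (suc μ)) (ι a ^ℚ suc μ) ⟩
        S + ι a * B (suc μ) * (ι a ^ℚ suc μ - 1ℚ)  ∎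
        where
        S = ∑[ κ < suc μ ] (ι (suc μ C κ) * B κ * ι a ^ℚ κ * aperyPowerSum (suc μ ∸ κ))
        factor : ∀ s a b p → (s + a * (b * p)) - a * b ≡ s + a * b * (p - 1ℚ)
        factor = Ring.solve-∀ ℚ-ring

    ∑-apery : ∀ (g : ℕ → ℚ) →
      ∑[ t < a ] g (apery t) ≡ ∑[ r < suc s ] g (r ℕ.* c) + ∑[ r < a ∸ s ∸ 1 ] g (suc r ℕ.* b)
    ∑-apery g = begin
      ∑[ t < a ] g (apery t)
        ≡⟨ cong (λ n → ∑[ t < n ] g (apery t)) 1+s+[a∸s∸1]≡a ⟨
      ∑[ t < suc s ℕ.+ M ] g (apery t)
        ≡⟨ ∑-split (suc s) M (g ∘ apery) ⟩
      ∑[ t < suc s ] g (apery t) + ∑[ i < M ] g (apery (suc s ℕ.+ i))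
        ≡⟨ cong₂ _+_ (∑-cong (suc s) (λ t t≤s → cong g (apery≡t*c (ℕ.≤-pred t≤s))))
                     (∑-cong M (λ i i<M → cong g (trans (apery≡[a∸t]*b (s≤s (ℕ.m≤m+n s i))) (cong (ℕ._* b) (reflect i i<M))))) ⟩
      ∑[ r < suc s ] g (r ℕ.* c) + ∑[ i < M ] g (suc (M ∸ suc i) ℕ.* b)
        ≡⟨ cong (_+_ (∑[ r < suc s ] g (r ℕ.* c))) (∑-reverse M (λ r → g (suc r ℕ.* b))) ⟨
      ∑[ r < suc s ] g (r ℕ.* c) + ∑[ r < M ] g (suc r ℕ.* b)  ∎
      where
      M = a ∸ s ∸ 1
      reflect : ∀ i → i < M → a ∸ (suc s ℕ.+ i) ≡ suc (M ∸ suc i)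
      reflect i i<M = begin
        a ∸ (suc s ℕ.+ i)              ≡⟨ cong (_∸ (suc s ℕ.+ i)) 1+s+[a∸s∸1]≡a ⟨
        (suc s ℕ.+ M) ∸ (suc s ℕ.+ i)  ≡⟨ ℕ.[m+n]∸[m+o]≡n∸o (suc s) M i ⟩
        M ∸ i                          ≡⟨ ℕ.+-∸-assoc 1 i<M ⟩
        suc (M ∸ suc i)                ∎

    ∑-ι-power-multiples : ∀ n (f : ℕ → ℕ) x p →
      ∑[ r < n ] (ι (f r ℕ.* x) ^ℚ p) ≡ ι (x ^ p) * ι (sumℕ (map (λ r → f r ^ p) (upTo n)))
    ∑-ι-power-multiples n f x p = begin
      ∑[ r < n ] (ι (f r ℕ.* x) ^ℚ p)                      ≡⟨ ∑-cong n (λ r _ → ι-power r) ⟩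
      ∑[ r < n ] (ι (x ^ p) * ι (f r ^ p))                 ≡⟨ *-distribˡ-∑ n (ι (x ^ p)) _ ⟨
      ι (x ^ p) * ∑[ r < n ] ι (f r ^ p)                   ≡⟨ cong (_*_ (ι (x ^ p))) (ι-sumℕ-map-upTo n (λ r → f r ^ p)) ⟨
      ι (x ^ p) * ι (sumℕ (map (λ r → f r ^ p) (upTo n)))  ∎
      where
      ι-power : ∀ r → ι (f r ℕ.* x) ^ℚ p ≡ ι (x ^ p) * ι (f r ^ p)
      ι-power r = begin
        ι (f r ℕ.* x) ^ℚ p       ≡⟨ ι-*-^ (f r) x p ⟩
        ι (f r) ^ℚ p * ι x ^ℚ p  ≡⟨ *-comm (ι (f r) ^ℚ p) (ι x ^ℚ p) ⟩
        ι x ^ℚ p * ι (f r) ^ℚ p  ≡⟨ cong₂ _*_ (ι-^ x p) (ι-^ (f r) p) ⟨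
        ι (x ^ p) * ι (f r ^ p)  ∎

    aperyPowerSum-split : ∀ p →
      aperyPowerSum p ≡ ι (c ^ p) * ι (sumℕ (map (λ r → r ^ p) (upTo (suc s))))
                      + ι (b ^ p) * ι (sumℕ (map (λ r → suc r ^ p) (upTo (a ∸ s ∸ 1))))
    aperyPowerSum-split p = trans (∑-apery (λ w → ι w ^ℚ p))
      (cong₂ _+_ (∑-ι-power-multiples (suc s) (λ r → r) c p) (∑-ι-power-multiples (a ∸ s ∸ 1) suc b p))

  module Formulas where

    open Cast
    open FiniteSums
    open Bernoulli
    open AperySet
    open PowerSums
    open import Data.Nat using (NonZero; _^_)
    import Data.Nat.Properties as ℕ
    open import Data.Nat.Combinatorics using (_C_)
    open import Data.List using (List; []; _∷_; length; map; upTo)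
    open import Data.Rational using (ℚ; 0ℚ; 1ℚ; _+_; _*_; _-_; -_)
    open import Data.Rational.Properties
    open import Relation.Binary.PropositionalEquality
      using (refl; sym; trans; cong; cong₂; subst; module ≡-Reasoning)
    import Tactic.RingSolver as Ring

    open ≡-Reasoning

    private instance
      2a≢0 : NonZero (2 ℕ.* a)
      2a≢0 = ℕ.m*n≢0 2 a
      12a≢0 : NonZero (12 ℕ.* a)
      12a≢0 = ℕ.m*n≢0 12 a

    -- The right-hand sides of the theorem, abstracted over the map ℕ → ℚ so that
    -- they are proved for ι and then transported to toℚ along ι≡toℚ.
    sylvesterTerm : (ℕ → ℚ) → ℕ → ℕ → ℚ
    sylvesterTerm q μ κ =
      q ((suc μ) C κ) * bernoulli κ * (q (a ^ κ) ÷ℕ a) *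
        (q (c ^ (suc μ ∸ κ)) * q (sumℕ (map (λ r → r ^ (suc μ ∸ κ)) (upTo (suc s))))
         + q (b ^ (suc μ ∸ κ)) * q (sumℕ (map (λ r → suc r ^ (suc μ ∸ κ)) (upTo (a ∸ s ∸ 1)))))

    sylvesterFormula : (ℕ → ℚ) → ℕ → ℚ
    sylvesterFormula q μ =
      (sumℚ (map (sylvesterTerm q μ) (upTo (suc μ))) ÷ℕ suc μ) + (bernoulli (suc μ) ÷ℕ suc μ) * (q (a ^ suc μ) - 1ℚ)

    sylvesterFormula-expand : ∀ μ →
      ι (suc μ) * (ι a * sylvesterFormula ι μ)
        ≡ ∑[ κ < suc μ ] (ι (suc μ C κ) * B κ * ι a ^ℚ κ * aperyPowerSum (suc μ ∸ κ))
          + ι a * B (suc μ) * (ι a ^ℚ suc μ - 1ℚ)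
    sylvesterFormula-expand μ = begin
      ι n * (A * ((T ÷ℕ n) + (B n ÷ℕ n) * (ι (a ^ n) - 1ℚ)))
        ≡⟨ regroup (ι n) A (T ÷ℕ n) (B n ÷ℕ n) (ι (a ^ n)) ⟩
      A * (T ÷ℕ n * ι n) + A * (B n ÷ℕ n * ι n) * (ι (a ^ n) - 1ℚ)
        ≡⟨ cong₂ (λ x y → A * x + A * y * (ι (a ^ n) - 1ℚ)) (÷ℕ-*-cancel T n) (÷ℕ-*-cancel (B n) n) ⟩
      A * T + A * B n * (ι (a ^ n) - 1ℚ)
        ≡⟨ cong₂ (λ x y → x + A * B n * (y - 1ℚ)) A*T (ι-^ a n) ⟩
      ∑[ κ < n ] (ι (n C κ) * B κ * A ^ℚ κ * aperyPowerSum (n ∸ κ)) + A * B n * (A ^ℚ n - 1ℚ)  ∎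
      where
      n = suc μ
      A = ι a
      T = sumℚ (map (sylvesterTerm ι μ) (upTo n))
      regroup : ∀ n a t β p → n * (a * (t + β * (p - 1ℚ))) ≡ a * (t * n) + a * (β * n) * (p - 1ℚ)
      regroup = Ring.solve-∀ ℚ-ring
      A*term : ∀ κ → A * sylvesterTerm ι μ κ ≡ ι (n C κ) * B κ * A ^ℚ κ * aperyPowerSum (n ∸ κ)
      A*term κ = begin
        A * sylvesterTerm ι μ κ
          ≡⟨ cong (λ z → A * (ι (n C κ) * B κ * (ι (a ^ κ) ÷ℕ a) * z)) (sym (aperyPowerSum-split (n ∸ κ))) ⟩
        A * (ι (n C κ) * B κ * (ι (a ^ κ) ÷ℕ a) * aperyPowerSum (n ∸ κ))
          ≡⟨ regroup′ A (ι (n C κ)) (B κ) (ι (a ^ κ) ÷ℕ a) (aperyPowerSum (n ∸ κ)) ⟩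
        ι (n C κ) * B κ * (ι (a ^ κ) ÷ℕ a * A) * aperyPowerSum (n ∸ κ)
          ≡⟨ cong (λ x → ι (n C κ) * B κ * x * aperyPowerSum (n ∸ κ)) (trans (÷ℕ-*-cancel (ι (a ^ κ)) a) (ι-^ a κ)) ⟩
        ι (n C κ) * B κ * A ^ℚ κ * aperyPowerSum (n ∸ κ)  ∎
        where
        regroup′ : ∀ a c β y z → a * (c * β * y * z) ≡ c * β * (y * a) * z
        regroup′ = Ring.solve-∀ ℚ-ring
      A*T : A * T ≡ ∑[ κ < n ] (ι (n C κ) * B κ * A ^ℚ κ * aperyPowerSum (n ∸ κ))
      A*T = trans (cong (A *_) (sumℚ-map-upTo n (sylvesterTerm ι μ))) (trans (*-distribˡ-∑ n A (sylvesterTerm ι μ)) (∑-cong n (λ κ _ → A*term κ)))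

    aperyPowerSum-suc : ∀ p →
      aperyPowerSum (suc p) ≡ ι c ^ℚ suc p * ∑[ r < s ] (ι (suc r) ^ℚ suc p)
                            + ι b ^ℚ suc p * ∑[ r < a ∸ s ∸ 1 ] (ι (suc r) ^ℚ suc p)
    aperyPowerSum-suc p = trans (∑-apery (λ w → ι w ^ℚ suc p)) (cong₂ _+_ c-multiples b-multiples)
      where
      scale : ∀ n x → ∑[ r < n ] (ι (suc r ℕ.* x) ^ℚ suc p) ≡ ι x ^ℚ suc p * ∑[ r < n ] (ι (suc r) ^ℚ suc p)
      scale n x = trans (∑-cong n (λ r _ → trans (ι-*-^ (suc r) x (suc p)) (*-comm (ι (suc r) ^ℚ suc p) (ι x ^ℚ suc p))))
                        (sym (*-distribˡ-∑ n (ι x ^ℚ suc p) (λ r → ι (suc r) ^ℚ suc p)))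
      c-multiples : ∑[ r < suc s ] (ι (r ℕ.* c) ^ℚ suc p) ≡ ι c ^ℚ suc p * ∑[ r < s ] (ι (suc r) ^ℚ suc p)
      c-multiples = begin
        ∑[ r < suc s ] (ι (r ℕ.* c) ^ℚ suc p)                   ≡⟨ ∑-head s _ ⟩
        ι 0 * ι 0 ^ℚ p + ∑[ r < s ] (ι (suc r ℕ.* c) ^ℚ suc p)  ≡⟨ cong (λ z → z * ι 0 ^ℚ p + ∑[ r < s ] (ι (suc r ℕ.* c) ^ℚ suc p)) ι-0 ⟩
        0ℚ * ι 0 ^ℚ p + ∑[ r < s ] (ι (suc r ℕ.* c) ^ℚ suc p)   ≡⟨ trans (cong (_+ ∑[ r < s ] (ι (suc r ℕ.* c) ^ℚ suc p)) (*-zeroˡ (ι 0 ^ℚ p))) (+-identityˡ _) ⟩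
        ∑[ r < s ] (ι (suc r ℕ.* c) ^ℚ suc p)                   ≡⟨ scale s c ⟩
        ι c ^ℚ suc p * ∑[ r < s ] (ι (suc r) ^ℚ suc p)          ∎
      b-multiples : ∑[ r < a ∸ s ∸ 1 ] (ι (suc r ℕ.* b) ^ℚ suc p) ≡ ι b ^ℚ suc p * ∑[ r < a ∸ s ∸ 1 ] (ι (suc r) ^ℚ suc p)
      b-multiples = scale (a ∸ s ∸ 1) b

    ι[a∸s∸1] : ι (a ∸ s ∸ 1) ≡ ι a - ι s - 1ℚ
    ι[a∸s∸1] = begin
      ι (a ∸ s ∸ 1)                            ≡⟨ isolate (ι (a ∸ s ∸ 1)) (ι s) ⟩
      ((ι s + 1ℚ) + ι (a ∸ s ∸ 1)) - ι s - 1ℚ  ≡⟨ cong (λ z → z - ι s - 1ℚ) (trans (cong (_+ ι (a ∸ s ∸ 1)) (sym (ι-suc s))) (sym (ι-+ (suc s) (a ∸ s ∸ 1)))) ⟩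
      ι (suc s ℕ.+ (a ∸ s ∸ 1)) - ι s - 1ℚ     ≡⟨ cong (λ n → ι n - ι s - 1ℚ) 1+s+[a∸s∸1]≡a ⟩
      ι a - ι s - 1ℚ                           ∎
      where
      isolate : ∀ m s → m ≡ ((s + 1ℚ) + m) - s - 1ℚ
      isolate = Ring.solve-∀ ℚ-ring

    ι[s*[1+s]] : ι (s ℕ.* suc s) ≡ ι s * (ι s + 1ℚ)
    ι[s*[1+s]] = trans (ι-* s (suc s)) (cong (ι s *_) (ι-suc s))

    ι2≡2 : ι 2 ≡ toℚ 2
    ι2≡2 = cong (λ f → f 2) ι≡toℚ

    countFormula : (ℕ → ℚ) → ℚ
    countFormula q = (q c ÷ℕ (2 ℕ.* a)) * q (s ℕ.* suc s)
                   + (q b ÷ℕ (2 ℕ.* a)) * ((q a - q s) * (q a - q s - 1ℚ))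
                   - ((q a - 1ℚ) ÷ℕ 2)

    countPolynomial : ℚ
    countPolynomial = ι c * (ι s * (ι s + 1ℚ)) + ι b * ((ι a - ι s) * (ι a - ι s - 1ℚ)) - ι a * (ι a - 1ℚ)

    countFormula≡ : toℚ 2 * (ι a * countFormula ι) ≡ countPolynomial
    countFormula≡ = begin
      toℚ 2 * (A * (u * SS + v * P - w))
        ≡⟨ distribute A u v w SS P ⟩
      u * (toℚ 2 * A) * SS + v * (toℚ 2 * A) * P - A * (w * toℚ 2)
        ≡⟨ cong₂ (λ x y → u * x * SS + v * x * P - A * (w * y)) 2a ι2≡2 ⟨
      u * ι (2 ℕ.* a) * SS + v * ι (2 ℕ.* a) * P - A * (w * ι 2)
        ≡⟨ cong₂ (λ x y → x * SS + y * P - A * (w * ι 2)) (÷ℕ-*-cancel (ι c) (2 ℕ.* a)) (÷ℕ-*-cancel (ι b) (2 ℕ.* a)) ⟩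
      ι c * SS + ι b * P - A * (w * ι 2)
        ≡⟨ cong (λ z → ι c * SS + ι b * P - A * z) (÷ℕ-*-cancel (A - 1ℚ) 2) ⟩
      ι c * SS + ι b * P - A * (A - 1ℚ)
        ≡⟨ cong (λ x → ι c * x + ι b * P - A * (A - 1ℚ)) ι[s*[1+s]] ⟩
      countPolynomial  ∎
      where
      A = ι a
      u = ι c ÷ℕ (2 ℕ.* a)
      v = ι b ÷ℕ (2 ℕ.* a)
      w = (A - 1ℚ) ÷ℕ 2
      SS = ι (s ℕ.* suc s)
      P = (A - ι s) * (A - ι s - 1ℚ)
      2a : ι (2 ℕ.* a) ≡ toℚ 2 * A
      2a = trans (ι-* 2 a) (cong (_* A) ι2≡2)
      distribute : ∀ a u v w x p → toℚ 2 * (a * (u * x + v * p - w)) ≡ u * (toℚ 2 * a) * x + v * (toℚ 2 * a) * p - a * (w * toℚ 2)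
      distribute = Ring.solve-∀ ℚ-ring

    sumFormula : (ℕ → ℚ) → ℚ
    sumFormula q = (((q c * q c * q (2 ℕ.* s ℕ.+ 1)) ÷ℕ (12 ℕ.* a)) - (q c ÷ℕ 4)) * q (s ℕ.* suc s)
                 + (((q b * q b * (q 2 * q a - q 2 * q s - 1ℚ)) ÷ℕ (12 ℕ.* a)) - (q b ÷ℕ 4)) * ((q a - q s) * (q a - q s - 1ℚ))
                 + ((q a * q a - 1ℚ) ÷ℕ 12)

    sumShape : ℚ → ℚ → ℚ → ℚ → ℚ → ℚ → ℚ → ℚ
    sumShape x₁ x₂ x₃ x₄ x₅ y p = x₁ * y - toℚ 3 * ι a * x₂ * y + x₃ * p - toℚ 3 * ι a * x₄ * p + ι a * x₅

    sumShape-cong : ∀ {x₁ x₂ x₃ x₄ x₅ y p x₁′ x₂′ x₃′ x₄′ x₅′ y′ p′} →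
      x₁ ≡ x₁′ → x₂ ≡ x₂′ → x₃ ≡ x₃′ → x₄ ≡ x₄′ → x₅ ≡ x₅′ → y ≡ y′ → p ≡ p′ →
      sumShape x₁ x₂ x₃ x₄ x₅ y p ≡ sumShape x₁′ x₂′ x₃′ x₄′ x₅′ y′ p′
    sumShape-cong refl refl refl refl refl refl refl = refl

    sumPolynomial : ℚ
    sumPolynomial = sumShape (ι c * ι c * (toℚ 2 * ι s + 1ℚ)) (ι c) (ι b * ι b * (toℚ 2 * ι a - toℚ 2 * ι s - 1ℚ)) (ι b)
                             (ι a * ι a - 1ℚ) (ι s * (ι s + 1ℚ)) ((ι a - ι s) * (ι a - ι s - 1ℚ))

    sumFormula≡ : toℚ 12 * (ι a * sumFormula ι) ≡ sumPolynomial
    sumFormula≡ = begin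
      toℚ 12 * (A * ((u₁ - u₂) * SS + (u₃ - u₄) * P + u₅))
        ≡⟨ distribute A u₁ u₂ u₃ u₄ u₅ SS P ⟩
      sumShape (u₁ * (toℚ 12 * A)) (u₂ * toℚ 4) (u₃ * (toℚ 12 * A)) (u₄ * toℚ 4) (u₅ * toℚ 12) SS P
        ≡⟨ sumShape-cong (clear u₁-cleared) (clear₄ (ι c)) (clear u₃-cleared) (clear₄ (ι b)) clear₁₂ ι[s*[1+s]] refl ⟩
      sumPolynomial  ∎
      where
      A = ι a
      u₁ = (ι c * ι c * ι (2 ℕ.* s ℕ.+ 1)) ÷ℕ (12 ℕ.* a)
      u₂ = ι c ÷ℕ 4
      u₃ = (ι b * ι b * (ι 2 * A - ι 2 * ι s - 1ℚ)) ÷ℕ (12 ℕ.* a)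
      u₄ = ι b ÷ℕ 4
      u₅ = (A * A - 1ℚ) ÷ℕ 12
      SS = ι (s ℕ.* suc s)
      P = (A - ι s) * (A - ι s - 1ℚ)
      12a : ι (12 ℕ.* a) ≡ toℚ 12 * A
      12a = trans (ι-* 12 a) (cong (λ f → f 12 * A) ι≡toℚ)
      clear : ∀ {x y} → x ≡ y → (x ÷ℕ (12 ℕ.* a)) * (toℚ 12 * A) ≡ y
      clear {x} x≡y = trans (cong (_*_ (x ÷ℕ (12 ℕ.* a))) (sym 12a)) (trans (÷ℕ-*-cancel x (12 ℕ.* a)) x≡y)
      clear₄ : ∀ x → (x ÷ℕ 4) * toℚ 4 ≡ x
      clear₄ x = trans (cong (λ f → (x ÷ℕ 4) * f 4) (sym ι≡toℚ)) (÷ℕ-*-cancel x 4)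
      clear₁₂ : u₅ * toℚ 12 ≡ A * A - 1ℚ
      clear₁₂ = trans (cong (λ f → u₅ * f 12) (sym ι≡toℚ)) (÷ℕ-*-cancel (A * A - 1ℚ) 12)
      u₁-cleared : ι c * ι c * ι (2 ℕ.* s ℕ.+ 1) ≡ ι c * ι c * (toℚ 2 * ι s + 1ℚ)
      u₁-cleared = cong (ι c * ι c *_) (trans (ι-+ (2 ℕ.* s) 1) (cong₂ _+_ (trans (ι-* 2 s) (cong (_* ι s) ι2≡2)) ι-1))
      u₃-cleared : ι b * ι b * (ι 2 * A - ι 2 * ι s - 1ℚ) ≡ ι b * ι b * (toℚ 2 * A - toℚ 2 * ι s - 1ℚ)
      u₃-cleared = cong (λ t → ι b * ι b * (t * A - t * ι s - 1ℚ)) ι2≡2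
      distribute : ∀ a u₁ u₂ u₃ u₄ u₅ x p →
        toℚ 12 * (a * ((u₁ - u₂) * x + (u₃ - u₄) * p + u₅))
          ≡ u₁ * (toℚ 12 * a) * x - toℚ 3 * a * (u₂ * toℚ 4) * x + u₃ * (toℚ 12 * a) * p - toℚ 3 * a * (u₄ * toℚ 4) * p + a * (u₅ * toℚ 12)
      distribute = Ring.solve-∀ ℚ-ring

    length≡∑-pow-0 : ∀ (xs : List ℕ) → length xs ≡ sumℕ (map (λ m → m ^ 0) xs)
    length≡∑-pow-0 []       = refl
    length≡∑-pow-0 (x ∷ xs) = cong suc (length≡∑-pow-0 xs)

    sum≡∑-pow-1 : ∀ (xs : List ℕ) → sumℕ xs ≡ sumℕ (map (λ m → m ^ 1) xs)
    sum≡∑-pow-1 []       = refl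
    sum≡∑-pow-1 (x ∷ xs) = cong₂ ℕ._+_ (sym (ℕ.*-identityʳ x)) (sum≡∑-pow-1 xs)

    module _ (N : ℕ) (representable-from-N : ∀ m → N ≤ m → Rep m) where

      gapPowerSum-0-polynomial : toℚ 2 * (ι a * ι (gapPowerSum N 0)) ≡ countPolynomial
      gapPowerSum-0-polynomial = begin
        toℚ 2 * (A * ι (gapPowerSum N 0))
          ≡⟨ cong (toℚ 2 *_) (sym (trans (cong (_* (A * ι (gapPowerSum N 0))) ι-1) (*-identityˡ (A * ι (gapPowerSum N 0))))) ⟩
        toℚ 2 * (ι 1 * (A * ι (gapPowerSum N 0)))
          ≡⟨ cong (toℚ 2 *_) (gapPowerSum-formula N representable-from-N 0) ⟩
        toℚ 2 * ((0ℚ + ι 1 * 1ℚ * 1ℚ * aperyPowerSum 1) + A * B 1 * (A * 1ℚ - 1ℚ))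
          ≡⟨ cong₂ (λ i w → toℚ 2 * ((0ℚ + i * 1ℚ * 1ℚ * w) + A * B 1 * (A * 1ℚ - 1ℚ))) ι-1 (aperyPowerSum-suc 0) ⟩
        toℚ 2 * ((0ℚ + 1ℚ * 1ℚ * 1ℚ * (ι c * 1ℚ * Σs + ι b * 1ℚ * ΣM)) + A * B 1 * (A * 1ℚ - 1ℚ))
          ≡⟨ distribute A (ι c) (ι b) Σs ΣM (B 1) ⟩
        ι c * (toℚ 2 * Σs) + ι b * (toℚ 2 * ΣM) + (toℚ 2 * B 1) * (A * A - A)
          ≡⟨ cong₂ (λ x y → ι c * x + ι b * y + (toℚ 2 * B 1) * (A * A - A))
                   (∑-naturals s) (trans (∑-naturals (a ∸ s ∸ 1)) (cong (λ m → m * (m + 1ℚ)) ι[a∸s∸1])) ⟩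
        ι c * (ι s * (ι s + 1ℚ)) + ι b * ((A - ι s - 1ℚ) * ((A - ι s - 1ℚ) + 1ℚ)) + (- 1ℚ) * (A * A - A)
          ≡⟨ collect A (ι s) (ι c) (ι b) ⟩
        countPolynomial  ∎
        where
        A = ι a
        Σs = ∑[ r < s ] (ι (suc r) ^ℚ 1)
        ΣM = ∑[ r < a ∸ s ∸ 1 ] (ι (suc r) ^ℚ 1)
        distribute : ∀ a c b σ τ β →
          toℚ 2 * ((0ℚ + 1ℚ * 1ℚ * 1ℚ * (c * 1ℚ * σ + b * 1ℚ * τ)) + a * β * (a * 1ℚ - 1ℚ))
            ≡ c * (toℚ 2 * σ) + b * (toℚ 2 * τ) + (toℚ 2 * β) * (a * a - a)
        distribute = Ring.solve-∀ ℚ-ring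
        collect : ∀ a s c b →
          c * (s * (s + 1ℚ)) + b * ((a - s - 1ℚ) * ((a - s - 1ℚ) + 1ℚ)) + (- 1ℚ) * (a * a - a)
            ≡ c * (s * (s + 1ℚ)) + b * ((a - s) * (a - s - 1ℚ)) - a * (a - 1ℚ)
        collect = Ring.solve-∀ ℚ-ring

      gapPowerSum-1-polynomial : toℚ 12 * (ι a * ι (gapPowerSum N 1)) ≡ sumPolynomial
      gapPowerSum-1-polynomial = begin
        toℚ 12 * (A * X)
          ≡⟨ halve (A * X) ⟩
        toℚ 6 * (toℚ 2 * (A * X))
          ≡⟨ cong (λ z → toℚ 6 * (z * (A * X))) ι2≡2 ⟨
        toℚ 6 * (ι 2 * (A * X))
          ≡⟨ cong (toℚ 6 *_) (gapPowerSum-formula N representable-from-N 1) ⟩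
        expansion (ι 1) (ι 2) (aperyPowerSum 2) (aperyPowerSum 1)
          ≡⟨ expansion-cong ι-1 ι2≡2 (aperyPowerSum-suc 1) (aperyPowerSum-suc 0) ⟩
        expansion 1ℚ (toℚ 2) (ι c * (ι c * 1ℚ) * Σ²s + ι b * (ι b * 1ℚ) * Σ²M) (ι c * 1ℚ * Σs + ι b * 1ℚ * ΣM)
          ≡⟨ distribute A (ι c) (ι b) Σ²s Σ²M Σs ΣM (B 1) (B 2) ⟩
        shape (toℚ 6 * Σ²s) (toℚ 6 * Σ²M) (toℚ 2 * Σs) (toℚ 2 * ΣM)
          ≡⟨ shape-cong (∑-squares s) (trans (∑-squares (a ∸ s ∸ 1)) (cong (λ m → m * (m + 1ℚ) * (toℚ 2 * m + 1ℚ)) ι[a∸s∸1]))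
                        (∑-naturals s) (trans (∑-naturals (a ∸ s ∸ 1)) (cong (λ m → m * (m + 1ℚ)) ι[a∸s∸1])) ⟩
        shape (ι s * (ι s + 1ℚ) * (toℚ 2 * ι s + 1ℚ)) (M′ * (M′ + 1ℚ) * (toℚ 2 * M′ + 1ℚ)) (ι s * (ι s + 1ℚ)) (M′ * (M′ + 1ℚ))
          ≡⟨ collect A (ι s) (ι c) (ι b) ⟩
        sumPolynomial  ∎
        where
        A = ι a
        X = ι (gapPowerSum N 1)
        M′ = A - ι s - 1ℚ
        Σs = ∑[ r < s ] (ι (suc r) ^ℚ 1)
        ΣM = ∑[ r < a ∸ s ∸ 1 ] (ι (suc r) ^ℚ 1)
        Σ²s = ∑[ r < s ] (ι (suc r) ^ℚ 2)
        Σ²M = ∑[ r < a ∸ s ∸ 1 ] (ι (suc r) ^ℚ 2)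
        expansion : ℚ → ℚ → ℚ → ℚ → ℚ
        expansion i j w₂ w₁ = toℚ 6 * (((0ℚ + i * 1ℚ * 1ℚ * w₂) + j * B 1 * (A * 1ℚ) * w₁) + A * B 2 * (A * (A * 1ℚ) - 1ℚ))
        expansion-cong : ∀ {i j w₂ w₁ i′ j′ w₂′ w₁′} → i ≡ i′ → j ≡ j′ → w₂ ≡ w₂′ → w₁ ≡ w₁′ →
          expansion i j w₂ w₁ ≡ expansion i′ j′ w₂′ w₁′
        expansion-cong refl refl refl refl = refl
        shape : ℚ → ℚ → ℚ → ℚ → ℚ
        shape σ₂ τ₂ σ τ = ι c * ι c * σ₂ + ι b * ι b * τ₂ + toℚ 3 * (toℚ 2 * B 1) * A * (ι c * σ + ι b * τ) + (toℚ 6 * B 2) * (A * A * A - A)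
        shape-cong : ∀ {σ₂ τ₂ σ τ σ₂′ τ₂′ σ′ τ′} → σ₂ ≡ σ₂′ → τ₂ ≡ τ₂′ → σ ≡ σ′ → τ ≡ τ′ → shape σ₂ τ₂ σ τ ≡ shape σ₂′ τ₂′ σ′ τ′
        shape-cong refl refl refl refl = refl
        halve : ∀ x → toℚ 12 * x ≡ toℚ 6 * (toℚ 2 * x)
        halve = Ring.solve-∀ ℚ-ring
        distribute : ∀ a c b σ₂ τ₂ σ τ β₁ β₂ →
          toℚ 6 * (((0ℚ + 1ℚ * 1ℚ * 1ℚ * (c * (c * 1ℚ) * σ₂ + b * (b * 1ℚ) * τ₂))
                     + toℚ 2 * β₁ * (a * 1ℚ) * (c * 1ℚ * σ + b * 1ℚ * τ)) + a * β₂ * (a * (a * 1ℚ) - 1ℚ))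
            ≡ c * c * (toℚ 6 * σ₂) + b * b * (toℚ 6 * τ₂)
              + toℚ 3 * (toℚ 2 * β₁) * a * (c * (toℚ 2 * σ) + b * (toℚ 2 * τ)) + (toℚ 6 * β₂) * (a * a * a - a)
        distribute = Ring.solve-∀ ℚ-ring
        collect : ∀ a s c b → let m = a - s - 1ℚ ; p = (a - s) * (a - s - 1ℚ) in
          c * c * (s * (s + 1ℚ) * (toℚ 2 * s + 1ℚ)) + b * b * (m * (m + 1ℚ) * (toℚ 2 * m + 1ℚ))
            + toℚ 3 * (- 1ℚ) * a * (c * (s * (s + 1ℚ)) + b * (m * (m + 1ℚ))) + 1ℚ * (a * a * a - a)
          ≡ c * c * (toℚ 2 * s + 1ℚ) * (s * (s + 1ℚ)) - toℚ 3 * a * c * (s * (s + 1ℚ))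
            + b * b * (toℚ 2 * a - toℚ 2 * s - 1ℚ) * p - toℚ 3 * a * b * p + a * (a * a - 1ℚ)
        collect = Ring.solve-∀ ℚ-ring

      gap-count : toℚ (length (NRbelow a b c N)) ≡ countFormula toℚ
      gap-count = subst (λ q → q (length (NRbelow a b c N)) ≡ countFormula q) ι≡toℚ (ι-*-cancelˡ a (toℚ-*-cancelˡ 2 (begin
        toℚ 2 * (ι a * ι (length (NRbelow a b c N)))  ≡⟨ cong (λ n → toℚ 2 * (ι a * ι n)) (length≡∑-pow-0 (NRbelow a b c N)) ⟩
        toℚ 2 * (ι a * ι (gapPowerSum N 0))           ≡⟨ gapPowerSum-0-polynomial ⟩
        countPolynomial                               ≡⟨ countFormula≡ ⟨
        toℚ 2 * (ι a * countFormula ι)                ∎)))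

      gap-sum : toℚ (sumℕ (NRbelow a b c N)) ≡ sumFormula toℚ
      gap-sum = subst (λ q → q (sumℕ (NRbelow a b c N)) ≡ sumFormula q) ι≡toℚ (ι-*-cancelˡ a (toℚ-*-cancelˡ 12 (begin
        toℚ 12 * (ι a * ι (sumℕ (NRbelow a b c N)))  ≡⟨ cong (λ n → toℚ 12 * (ι a * ι n)) (sum≡∑-pow-1 (NRbelow a b c N)) ⟩
        toℚ 12 * (ι a * ι (gapPowerSum N 1))         ≡⟨ gapPowerSum-1-polynomial ⟩
        sumPolynomial                                ≡⟨ sumFormula≡ ⟨
        toℚ 12 * (ι a * sumFormula ι)                ∎)))

      sylvester-sum : ∀ μ → toℚ (gapPowerSum N μ) ≡ sylvesterFormula toℚ μ
      sylvester-sum μ = subst (λ q → q (gapPowerSum N μ) ≡ sylvesterFormula q μ) ι≡toℚ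
        (ι-*-cancelˡ a (ι-*-cancelˡ (suc μ) (trans (gapPowerSum-formula N representable-from-N μ) (sym (sylvesterFormula-expand μ)))))

open import Data.Product using (_,_)
open import Relation.Binary.PropositionalEquality using (refl; subst; trans)
open Cast using (ι≡toℚ)

theorem3p11 : (a d h : ℕ) → 0 < a → 0 < d → 0 < h → gcd a d ≡ 1 → 1 < h ℕ.* a ∸ d →
  let b = h ℕ.* a ∸ d
      c = h ℕ.* a ℕ.+ d
      s = floorDiv b (2 ℕ.* h)
      s⁺ = ceilDiv b (2 ℕ.* h)
      q = toℚ
      g = (+ (s ℕ.* c) ℤ.- + a) ℤ.⊔ ((+ a ℤ.- + s⁺) ℤ.* + b ℤ.- + a)
      P = (q a ℚ.- q s) ℚ.* (q a ℚ.- q s ℚ.- 1ℚ)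
      nF = (q c ÷ℕ (2 ℕ.* a)) ℚ.* q (s ℕ.* suc s)
           ℚ.+ (q b ÷ℕ (2 ℕ.* a)) ℚ.* P
           ℚ.- ((q a ℚ.- 1ℚ) ÷ℕ 2)
      sF = (((q c ℚ.* q c ℚ.* q (2 ℕ.* s ℕ.+ 1)) ÷ℕ (12 ℕ.* a)) ℚ.- (q c ÷ℕ 4)) ℚ.* q (s ℕ.* suc s)
           ℚ.+ (((q b ℚ.* q b ℚ.* (q 2 ℚ.* q a ℚ.- q 2 ℚ.* q s ℚ.- 1ℚ)) ÷ℕ (12 ℕ.* a)) ℚ.- (q b ÷ℕ 4)) ℚ.* P
           ℚ.+ ((q a ℚ.* q a ℚ.- 1ℚ) ÷ℕ 12)
      term = λ (μ κ : ℕ) →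
        q ((suc μ) C κ) ℚ.* bernoulli κ ℚ.* (q (a ^ κ) ÷ℕ a) ℚ.*
          (q (c ^ (suc μ ∸ κ)) ℚ.* q (sumℕ (map (λ r → r ^ (suc μ ∸ κ)) (upTo (suc s))))
           ℚ.+ q (b ^ (suc μ ∸ κ)) ℚ.* q (sumℕ (map (λ r → suc r ^ (suc μ ∸ κ)) (upTo (a ∸ s ∸ 1)))))
      sμF = λ (μ : ℕ) →
        (sumℚ (map (term μ) (upTo (suc μ))) ÷ℕ suc μ)
        ℚ.+ (bernoulli (suc μ) ÷ℕ suc μ) ℚ.* (q (a ^ suc μ) ℚ.- 1ℚ)
  in ((∀ (m : ℕ) → g ℤ.< + m → Representable a b c m)
      × (∀ (m : ℕ) → + m ≡ g → ¬ Representable a b c m))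
     × (∀ (N : ℕ) → (∀ (m : ℕ) → N ≤ m → Representable a b c m) →
         let L = NRbelow a b c N in
         (q (length L) ≡ nF)
         × (q (sumℕ L) ≡ sF)
         × (∀ (μ : ℕ) → 1 ≤ μ → q (sumℕ (map (λ m → m ^ μ) L)) ≡ sμF μ))
theorem3p11 a d h 0<a 0<d 0<h coprime 1<b =
  ( (λ m g<m → above-frobenius-representable m (subst (ℤ._< + m) frobenius-formula g<m))
  , (λ m m≡g → frobenius-not-representable m (trans m≡g frobenius-formula)) )
  , λ N representable-from-N →
      gap-count N representable-from-N , gap-sum N representable-from-N , λ μ _ → sylvester-sum N representable-from-N μ
  where
  instance
    a≢0 : ℕ.NonZero a
    a≢0 = ℕ.>-nonZero 0<a
    h≢0 : ℕ.NonZero h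
    h≢0 = ℕ.>-nonZero 0<h
  open Semigroup a h d _ _ _ _ refl refl refl refl 0<d coprime 1<b
  open AperySet
  open PowerSums
  open Formulas
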